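{- Let $m,n$ be positive integers with at least one of $m,n$ greater than $1$, and let $\mathcal{K}_{m,n}$ be the Klein-bottle knight's graph described in the context. Then $\mathcal{K}_{m,n}$ admits a cylindrical knight's tour if and only if neither of the following holds: - $m=2$ and $n=2$; - $m$ is odd and $n$ is even.
   Context: Fix positive integers $m,n$. Knight moves are displacements $(c,d)\in\mathbb{Z}^2$ with $\{|c|,|d|\}=\{1,2\}$. The plane graph $\mathcal{P}$ has vertex set $\mathbb{Z}^2$, with an edge between vertices differing by a knight move. Let $t(a,b)=(a+m,b)$ and $\tau(a,b)=(m-1-a,\,b+n)$. The Klein-bottle knight's graph $\mathcal{K}_{m,n}$ is the quotient of $\mathcal{P}$ by the group $\langle t,\tau\rangle$ (orbits of vertices and of edges), so it may be a pseudograph. It has $mn$ vertices, represented by $(a,b)$ with $0\le a<m$ and $0\le b<n$. It models knight moves on the Klein bottle $K$ obtained from an $m\times n$ rectangle by gluing left to right without a twist and top to bottom with a twist. A knight's tour is a Hamiltonian cycle based at $(0,0)$. A tour is cylindrical if, under the natural map into $K$, it represents the element of $\pi_1(K)$ that is the image of a generator of the fundamental group of the cylinder (the rectangle with left and right edges glued) under the quotient map. Equivalently, its unique lift to $\mathcal{P}$ starting at $(0,0)$ ends at $(m,0)$ or $(-m,0)$. -}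

module Defs where

open import Data.Nat using (ℕ; zero; suc; _<_; _*_)
open import Data.Integer as ℤ using (ℤ; +_; ∣_∣; -_)
open import Data.Product using (_×_; _,_; ∃; ∃-syntax; Σ)
open import Data.Sum using (_⊎_)
open import Data.Fin using (Fin; toℕ)
open import Relation.Binary.PropositionalEquality using (_≡_)
open import Relation.Binary.Construct.Closure.ReflexiveTransitive using (Star)

Pt : Set
Pt = ℤ × ℤ

IsKnightMove : Pt → Set
IsKnightMove (c , d) = (∣ c ∣ ≡ 1 × ∣ d ∣ ≡ 2) ⊎ (∣ c ∣ ≡ 2 × ∣ d ∣ ≡ 1)

Adj𝒫 : Pt → Pt → Set
Adj𝒫 (a , b) (a' , b') = IsKnightMove (a' ℤ.- a , b' ℤ.- b)

t : ℕ → Pt → Pt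
t m (a , b) = (a ℤ.+ + m , b)

τ : ℕ → ℕ → Pt → Pt
τ m n (a , b) = (+ m ℤ.- + 1 ℤ.- a , b ℤ.+ + n)

data GenStep (m n : ℕ) : Pt → Pt → Set where
  by-t    : ∀ p → GenStep m n p (t m p)
  by-t⁻¹  : ∀ p → GenStep m n (t m p) p
  by-τ    : ∀ p → GenStep m n p (τ m n p)
  by-τ⁻¹  : ∀ p → GenStep m n (τ m n p) p

-- p and q lie in the same orbit of the group ⟨t, τ⟩, i.e. they are the
-- same vertex of the Klein-bottle knight's graph 𝒦_{m,n}.
SameVertex : ℕ → ℕ → Pt → Pt → Set
SameVertex m n = Star (GenStep m n)

-- A cylindrical knight's tour of 𝒦_{m,n}, given by its unique lift
-- p 0, p 1, …, p (m*n) to the plane starting at (0,0):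
--  * consecutive lifted points differ by a knight move (the walk uses edges of 𝒦_{m,n}),
--  * the points p 0, …, p (m*n - 1) represent pairwise distinct vertices,
--  * every vertex (a , b), 0 ≤ a < m, 0 ≤ b < n, is visited,
--  * the lift ends at (m,0) or (-m,0) (so the walk closes up and is cylindrical).
record CylindricalTour (m n : ℕ) : Set where
  field
    pos       : ℕ → Pt
    start     : pos 0 ≡ (+ 0 , + 0)
    knight    : ∀ i → i < m * n → Adj𝒫 (pos i) (pos (suc i))
    distinct  : ∀ i j → i < m * n → j < m * n →
                SameVertex m n (pos i) (pos j) → i ≡ j
    covers    : (a : Fin m) (b : Fin n) →
                ∃[ i ] (i < m * n × SameVertex m n (pos i) (+ toℕ a , + toℕ b))
    cylinder  : (pos (m * n) ≡ (+ m , + 0)) ⊎ (pos (m * n) ≡ (- (+ m) , + 0))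

HasCylindricalTour : ℕ → ℕ → Set
HasCylindricalTour m n = CylindricalTour m n

-- The vertex of a
-- point is computed explicitly (reduce modulo (m , 2n) and fold the upper half back by
-- τ), so a lifted knight's walk of length m n from (0 , 0) to (m , 0) meeting every
-- vertex is a tour.  Such walks are mostly obtained by repeating a short walk from
-- (0 , 0) to (d , 0) side by side m / d times: d = 1 for odd n ≥ 3, d = 2 for m, n even
-- with n ≥ 4, d = 4 for n = 2 and 4 ∣ m; the cases n = 1 and n = 2, m ≡ 2 (mod 4) are
-- explicit.  Conversely, a knight move changes x + y by an odd amount, which forces
-- m ≡ m n (mod 2) for a cylindrical tour.  On the 2 × 2 board a (± 1 , ± 2) move does
-- not leave its vertex, so a tour would consist of four (± 2 , ± 1) moves, two
-- consecutive ones cancelling vertically, and would thus revisit a vertex.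
module Submission where

open import Defs
open import Data.Nat as ℕ using (ℕ; zero; suc; z≤n; s≤s; NonZero; _+_; _*_; _∸_; _<_; _≤_; _%_; _/_)
import Data.Nat.Properties as ℕP
import Data.Nat.DivMod as ℕD
open import Data.Nat.Divisibility using (_∣_; divides)
import Data.Nat.Tactic.RingSolver as ℕ-Solver
open import Data.Integer as ℤ using (ℤ; +_; -[1+_]; ∣_∣)
import Data.Integer.Properties as ℤP
open import Data.Integer.DivMod using (_%ℕ_; _/ℕ_; a≡a%ℕn+[a/ℕn]*n; n%ℕd<d)
import Data.Integer.Tactic.RingSolver as ℤ-Solver
open import Data.Fin using (Fin; toℕ; fromℕ<; punchOut)
import Data.Fin.Properties as FinP
open import Data.Product using (_×_; _,_; proj₁; proj₂; ∃)
open import Data.Sum using (_⊎_; inj₁; inj₂)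
open import Data.Empty using (⊥; ⊥-elim)
open import Relation.Nullary using (¬_; yes; no)
open import Relation.Nullary.Decidable using (True; toWitness)
open import Relation.Binary.PropositionalEquality
open import Relation.Binary.Definitions using (tri<; tri≈; tri>)
open import Relation.Binary.Construct.Closure.ReflexiveTransitive using (ε; _◅_; _◅◅_; reverse)
open import Function.Bundles using (_⇔_; mk⇔)

≤-lit : ∀ {a b} {_ : True (a ℕ.≤? b)} → a ≤ b
≤-lit {_} {_} {a≤b} = toWitness a≤b

injective⇒surjective : ∀ {N} (f : Fin N → Fin N) →
  (∀ x y → f x ≡ f y → x ≡ y) → ∀ y → ∃ λ x → f x ≡ y
injective⇒surjective {zero} f f-inj ()
injective⇒surjective {suc N} f f-inj y with FinP.any? (λ x → f x Data.Fin.≟ y)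
... | yes hit = hit
... | no miss = ⊥-elim (FinP.<⇒≢ i<j (f-inj i j (FinP.punchOut-injective (y≢f i) (y≢f j) f'i≡f'j)))
  where
  y≢f : ∀ x → y ≢ f x
  y≢f x eq = miss (x , sym eq)
  -- Missing y, f factors through Fin N, so pigeonhole gives a collision.
  collision = FinP.pigeonhole (ℕP.n<1+n N) (λ x → punchOut (y≢f x))
  i = proj₁ collision
  j = proj₁ (proj₂ collision)
  i<j = proj₁ (proj₂ (proj₂ collision))
  f'i≡f'j = proj₂ (proj₂ (proj₂ collision))

surjective⇒injective : ∀ {N} (f : Fin N → Fin N) →
  (∀ y → ∃ λ x → f x ≡ y) → ∀ x x' → f x ≡ f x' → x ≡ x'
surjective⇒injective {N} f f-surj x x' fx≡fx' = begin
  x                     ≡⟨ sym (proj₂ (g-surj x)) ⟩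
  g (proj₁ (g-surj x))  ≡⟨ cong g preimages-equal ⟩
  g (proj₁ (g-surj x')) ≡⟨ proj₂ (g-surj x') ⟩
  x' ∎
  where
  open ≡-Reasoning
  g : Fin N → Fin N
  g y = proj₁ (f-surj y)
  f∘g : ∀ y → f (g y) ≡ y
  f∘g y = proj₂ (f-surj y)
  g-injective : ∀ y y' → g y ≡ g y' → y ≡ y'
  g-injective y y' e = trans (sym (f∘g y)) (trans (cong f e) (f∘g y'))
  g-surj = injective⇒surjective g g-injective
  preimages-equal : proj₁ (g-surj x) ≡ proj₁ (g-surj x')
  preimages-equal = begin
    proj₁ (g-surj x)          ≡⟨ sym (f∘g _) ⟩
    f (g (proj₁ (g-surj x)))  ≡⟨ cong f (proj₂ (g-surj x)) ⟩
    f x                       ≡⟨ fx≡fx' ⟩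
    f x'                      ≡⟨ cong f (sym (proj₂ (g-surj x'))) ⟩
    f (g (proj₁ (g-surj x'))) ≡⟨ f∘g _ ⟩
    proj₁ (g-surj x') ∎

remainder-unique : ∀ k r r' (q q' : ℤ) → r < k → r' < k →
  + r ℤ.+ q ℤ.* + k ≡ + r' ℤ.+ q' ℤ.* + k → r ≡ r'
remainder-unique k r r' q q' r<k r'<k eq =
  ℤP.+-injective (ℤP.i-j≡0⇒i≡j (+ r) (+ r') (ℤP.∣i∣≡0⇒i≡0 ∣r-r'∣≡0))
  where
  r-r'≡[q'-q]k : + r ℤ.- + r' ≡ (q' ℤ.- q) ℤ.* + k
  r-r'≡[q'-q]k = begin
    + r ℤ.- + r'
      ≡⟨ rearrange (+ r) (+ r') q q' (+ k) ⟩
    (+ r ℤ.+ q ℤ.* + k) ℤ.- (+ r' ℤ.+ q' ℤ.* + k) ℤ.+ (q' ℤ.- q) ℤ.* + k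
      ≡⟨ cong (λ z → z ℤ.- (+ r' ℤ.+ q' ℤ.* + k) ℤ.+ (q' ℤ.- q) ℤ.* + k) eq ⟩
    (+ r' ℤ.+ q' ℤ.* + k) ℤ.- (+ r' ℤ.+ q' ℤ.* + k) ℤ.+ (q' ℤ.- q) ℤ.* + k
      ≡⟨ cancel (+ r' ℤ.+ q' ℤ.* + k) ((q' ℤ.- q) ℤ.* + k) ⟩
    (q' ℤ.- q) ℤ.* + k ∎
    where
    open ≡-Reasoning
    rearrange : ∀ a b c d e → a ℤ.- b ≡ (a ℤ.+ c ℤ.* e) ℤ.- (b ℤ.+ d ℤ.* e) ℤ.+ (d ℤ.- c) ℤ.* e
    rearrange = ℤ-Solver.solve-∀
    cancel : ∀ a b → a ℤ.- a ℤ.+ b ≡ b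
    cancel = ℤ-Solver.solve-∀
  ∣r-r'∣≡[∣q'-q∣]k : ∣ + r ℤ.- + r' ∣ ≡ ∣ q' ℤ.- q ∣ ℕ.* k
  ∣r-r'∣≡[∣q'-q∣]k = trans (cong ∣_∣ r-r'≡[q'-q]k) (ℤP.abs-* (q' ℤ.- q) (+ k))
  ∣r-r'∣<k : ∣ + r ℤ.- + r' ∣ < k
  ∣r-r'∣<k rewrite ℤP.m-n≡m⊖n r r' with ℕP.≤-total r r'
  ... | inj₁ r≤r' rewrite ℤP.∣⊖∣-≤ r≤r' = ℕP.≤-<-trans (ℕP.m∸n≤m r' r) r'<k
  ... | inj₂ r'≤r rewrite ℤP.∣m⊖n∣≡∣n⊖m∣ r r' | ℤP.∣⊖∣-≤ r'≤r = ℕP.≤-<-trans (ℕP.m∸n≤m r r') r<k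
  ∣r-r'∣≡0 : ∣ + r ℤ.- + r' ∣ ≡ 0
  ∣r-r'∣≡0 with ∣ q' ℤ.- q ∣ in eq
  ... | zero = trans ∣r-r'∣≡[∣q'-q∣]k (cong (ℕ._* k) eq)
  ... | suc u = ⊥-elim (ℕP.<⇒≱ ∣r-r'∣<k (subst (k ≤_)
          (sym (trans ∣r-r'∣≡[∣q'-q∣]k (cong (ℕ._* k) eq))) (ℕP.m≤m+n k (u ℕ.* k))))

%ℕ-≡ : ∀ k .{{_ : NonZero k}} (z : ℤ) r (q : ℤ) → r < k → z ≡ + r ℤ.+ q ℤ.* + k → z %ℕ k ≡ r
%ℕ-≡ k z r q r<k eq = remainder-unique k (z %ℕ k) r (z /ℕ k) q (n%ℕd<d z k) r<k
  (trans (sym (a≡a%ℕn+[a/ℕn]*n z k)) eq)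

m≡n+o⇒m∸o≡n : ∀ a b c → a ≡ c + b → a ∸ b ≡ c
m≡n+o⇒m∸o≡n a b c a≡c+b = trans (cong (_∸ b) a≡c+b) (ℕP.m+n∸n≡m c b)

+4*-cancel-< : ∀ c q T → c + q * 4 < c + T * 4 → q < T
+4*-cancel-< c q T lt = ℕP.*-cancelʳ-< 4 q T (ℕP.+-cancelˡ-< c _ _ lt)

pos-∸ : ∀ a b → b ≤ a → + (a ∸ b) ≡ + a ℤ.- + b
pos-∸ a b b≤a = trans (sym (ℤP.⊖-≥ b≤a)) (sym (ℤP.m-n≡m⊖n a b))

module _ (P : ℕ) .{{_ : NonZero P}} where

  [r+jP]%P≡r : ∀ r j → r < P → (r + j * P) % P ≡ r
  [r+jP]%P≡r r j r<P = trans (ℕD.[m+kn]%n≡m%n r j P) (ℕD.m<n⇒m%n≡m r<P)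

  [r+jP]/P≡j : ∀ r j → r < P → (r + j * P) / P ≡ j
  [r+jP]/P≡j r j r<P = begin
    (r + j * P) / P    ≡⟨ ℕD.+-distrib-/-∣ʳ r (divides j refl) ⟩
    r / P + j * P / P  ≡⟨ cong₂ _+_ (ℕD.m<n⇒m/n≡0 r<P) (ℕD.m*n/n≡m j P) ⟩
    j ∎
    where open ≡-Reasoning

  suc-%-no-wrap : ∀ i → suc (i % P) < P → suc i % P ≡ suc (i % P) × suc i / P ≡ i / P
  suc-%-no-wrap i lt = subst (λ z → z % P ≡ suc (i % P) × z / P ≡ i / P)
    (sym (cong suc (ℕD.m≡m%n+[m/n]*n i P)))
    ([r+jP]%P≡r (suc (i % P)) (i / P) lt , [r+jP]/P≡j (suc (i % P)) (i / P) lt)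

  suc-%-wrap : ∀ i → suc (i % P) ≡ P → suc i % P ≡ 0 × suc i / P ≡ suc (i / P)
  suc-%-wrap i eq = subst (λ z → z % P ≡ 0 × z / P ≡ suc (i / P)) e
    ([r+jP]%P≡r 0 (suc (i / P)) 0<P , [r+jP]/P≡j 0 (suc (i / P)) 0<P)
    where
    0<P : 0 < P
    0<P = ℕP.≤-trans (s≤s z≤n) (ℕP.≤-reflexive eq)
    e : 0 + suc (i / P) * P ≡ suc i
    e = trans (cong (_+ (i / P) * P) (sym eq)) (sym (cong suc (ℕD.m≡m%n+[m/n]*n i P)))

cyclic-difference : ∀ c v y → v < c → ∃ λ j → j < c × ∃ λ K → j + y ≡ v + c * K
cyclic-difference c v zero v<c = v , v<c , 0 , cong (λ z → v + z) (sym (ℕP.*-zeroʳ c))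
cyclic-difference c v (suc y) v<c with cyclic-difference c v y v<c
... | suc j , j<c , K , e = j , ℕP.<-trans (ℕP.n<1+n j) j<c , K , trans (ℕP.+-suc j y) e
... | zero , 0<c , K , e = c ∸ 1 , ℕP.∸-monoʳ-< {c} {1} {0} (s≤s z≤n) 0<c , suc K , (begin
  c ∸ 1 + suc y      ≡⟨ ℕP.+-suc (c ∸ 1) y ⟩
  suc (c ∸ 1) + y    ≡⟨ cong (_+ y) (ℕP.m+[n∸m]≡n {1} {c} 0<c) ⟩
  c + y              ≡⟨ cong (λ z → c + z) e ⟩
  c + (v + c * K)    ≡⟨ shuffle c v K ⟩
  v + c * suc K ∎)
  where
  open ≡-Reasoning
  shuffle : ∀ a b k → a + (b + a * k) ≡ b + a * suc k
  shuffle = ℕ-Solver.solve-∀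

∃-strip-offset : ∀ d c m .{{_ : NonZero d}} .{{_ : NonZero m}} → d * c ≡ m → ∀ x u →
  x % d ≡ u % d → u < m → ∃ λ j → j < c × (d * j + x) % m ≡ u
∃-strip-offset d c m dc≡m x u x≡u u<m = j , j<c ,
  trans (cong (_% m) dj+x≡u+Km) (trans (ℕD.[m+kn]%n≡m%n u K m) (ℕD.m<n⇒m%n≡m u<m))
  where
  u/d<c : u / d < c
  u/d<c = ℕD.m<n*o⇒m/o<n (subst (u <_) (trans (sym dc≡m) (ℕP.*-comm d c)) u<m)
  diff = cyclic-difference c (u / d) (x / d) u/d<c
  j = proj₁ diff
  j<c = proj₁ (proj₂ diff)
  K = proj₁ (proj₂ (proj₂ diff))
  j+x/d≡u/d+cK = proj₂ (proj₂ (proj₂ diff))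
  dj+x≡u+Km : d * j + x ≡ u + K * m
  dj+x≡u+Km = begin
    d * j + x                        ≡⟨ cong (λ z → d * j + z) (ℕD.m≡m%n+[m/n]*n x d) ⟩
    d * j + (x % d + x / d * d)      ≡⟨ cong (λ z → d * j + (z + x / d * d)) x≡u ⟩
    d * j + (u % d + x / d * d)      ≡⟨ collect d j (u % d) (x / d) ⟩
    u % d + d * (j + x / d)          ≡⟨ cong (λ z → u % d + d * z) j+x/d≡u/d+cK ⟩
    u % d + d * (u / d + c * K)      ≡⟨ spread d (u % d) (u / d) c K ⟩
    (u % d + u / d * d) + K * (d * c) ≡⟨ cong₂ _+_ (sym (ℕD.m≡m%n+[m/n]*n u d)) (cong (K *_) dc≡m) ⟩
    u + K * m ∎
    where
    open ≡-Reasoning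
    collect : ∀ a b e f → a * b + (e + f * a) ≡ e + a * (b + f)
    collect = ℕ-Solver.solve-∀
    spread : ∀ a b e f g → b + a * (e + f * g) ≡ (b + e * a) + g * (a * f)
    spread = ℕ-Solver.solve-∀

reflect-% : ∀ d c m .{{_ : NonZero d}} → d * c ≡ m → ∀ a → a < m →
  (m ∸ 1 ∸ a) % d ≡ (d ∸ 1) ∸ (a % d)
reflect-% d zero m dc≡m a a<m = ⊥-elim (ℕP.n≮0 (subst (a <_) (trans (sym dc≡m) (ℕP.*-zeroʳ d)) a<m))
reflect-% d@(suc d') c@(suc c') m dc≡m a a<m =
  trans (cong (_% d) m-1-a≡) (trans (ℕD.[m+kn]%n≡m%n (d' ∸ e) (c' ∸ A) d)
                                    (ℕD.m<n⇒m%n≡m (s≤s (ℕP.m∸n≤m d' e))))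
  where
  e = a % d
  A = a / d
  e≤d' : e ≤ d'
  e≤d' = ℕP.≤-pred (ℕD.m%n<n a d)
  A≤c' : A ≤ c'
  A≤c' = ℕP.≤-pred (ℕD.m<n*o⇒m/o<n (subst (a <_) (trans (sym dc≡m) (ℕP.*-comm d c)) a<m))
  total : (d' ∸ e) + (c' ∸ A) * d + a + 1 ≡ m
  total = begin
    (d' ∸ e) + (c' ∸ A) * d + a + 1
      ≡⟨ cong (λ z → (d' ∸ e) + (c' ∸ A) * d + z + 1) (ℕD.m≡m%n+[m/n]*n a d) ⟩
    (d' ∸ e) + (c' ∸ A) * d + (e + A * d) + 1
      ≡⟨ regroup (d' ∸ e) (c' ∸ A) d' e A ⟩
    ((d' ∸ e) + e + 1) + ((c' ∸ A) + A) * d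
      ≡⟨ cong₂ (λ u v → (u + 1) + v * d) (ℕP.m∸n+n≡m e≤d') (ℕP.m∸n+n≡m A≤c') ⟩
    (d' + 1) + c' * d
      ≡⟨ expand d' c' ⟩
    d * c
      ≡⟨ dc≡m ⟩
    m ∎
    where
    open ≡-Reasoning
    regroup : ∀ p q r s t → p + q * suc r + (s + t * suc r) + 1 ≡ (p + s + 1) + (q + t) * suc r
    regroup = ℕ-Solver.solve-∀
    expand : ∀ r q → r + 1 + q * suc r ≡ suc r * suc q
    expand = ℕ-Solver.solve-∀
  m-1-a≡ : m ∸ 1 ∸ a ≡ (d' ∸ e) + (c' ∸ A) * d
  m-1-a≡ = sym (trans (sym (ℕP.m+n∸n≡m _ a))
    (cong (_∸ a) (trans (sym (ℕP.m+n∸n≡m _ 1)) (cong (_∸ 1) total))))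

Adj𝒫-subst : ∀ {p q p' q'} → p ≡ p' → q ≡ q' → Adj𝒫 p' q' → Adj𝒫 p q
Adj𝒫-subst refl refl adj = adj

Adj𝒫-translate : ∀ D E a b a' b' → Adj𝒫 (+ a , + b) (+ a' , + b') →
  Adj𝒫 (+ (D + a) , + (E + b)) (+ (D + a') , + (E + b'))
Adj𝒫-translate D E a b a' b' = subst₂ (λ u v → IsKnightMove (u , v))
  (sym (cancel (+ D) (+ a) (+ a'))) (sym (cancel (+ E) (+ b) (+ b')))
  where
  cancel : ∀ u v w → (u ℤ.+ w) ℤ.- (u ℤ.+ v) ≡ w ℤ.- v
  cancel = ℤ-Solver.solve-∀

Adj𝒫-by-diffs : ∀ {a b a' b'} (c d : ℤ) → + a' ℤ.- + a ≡ c → + b' ℤ.- + b ≡ d →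
  IsKnightMove (c , d) → Adj𝒫 (+ a , + b) (+ a' , + b')
Adj𝒫-by-diffs _ _ refl refl move = move

rise : ∀ {x x' a} k → x ≡ a → x' ≡ a + k → + x' ℤ.- + x ≡ + k
rise {a = a} k refl refl = cancel (+ a) (+ k)
  where
  cancel : ∀ u v → u ℤ.+ v ℤ.- u ≡ v
  cancel = ℤ-Solver.solve-∀

fall : ∀ {x x' a} k → x ≡ a + k → x' ≡ a → + x' ℤ.- + x ≡ ℤ.- + k
fall {a = a} k refl refl = cancel (+ a) (+ k)
  where
  cancel : ∀ u v → u ℤ.- (u ℤ.+ v) ≡ ℤ.- v
  cancel = ℤ-Solver.solve-∀

-- Since τ² is the
-- translation by (0 , 2n), a point is first reduced to [0,m) × [0,2n); the upper
-- half is then folded back onto [0,m) × [0,n) by τ⁻¹.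
module Vertices (m' n' : ℕ) where
  m n 2n : ℕ
  m = suc m'
  n = suc n'
  2n = n + n

  fold : ℕ → ℕ → ℕ × ℕ
  fold a σ with σ ℕ.<? n
  ... | yes _ = (a , σ)
  ... | no _ = (m' ∸ a , σ ∸ n)

  fold-low : ∀ a σ → σ < n → fold a σ ≡ (a , σ)
  fold-low a σ σ<n with σ ℕ.<? n
  ... | yes _ = refl
  ... | no σ≮n = ⊥-elim (σ≮n σ<n)

  fold-high : ∀ a σ → n ≤ σ → fold a σ ≡ (m' ∸ a , σ ∸ n)
  fold-high a σ n≤σ with σ ℕ.<? n
  ... | yes σ<n = ⊥-elim (ℕP.<⇒≱ σ<n n≤σ)
  ... | no _ = refl

  low⊎high : ∀ σ → σ < n ⊎ n ≤ σ
  low⊎high σ with σ ℕ.<? n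
  ... | yes σ<n = inj₁ σ<n
  ... | no σ≮n = inj₂ (ℕP.≮⇒≥ σ≮n)

  vertex : Pt → ℕ × ℕ
  vertex (x , y) = fold (x %ℕ m) (y %ℕ 2n)

  infix 4 _~_
  _~_ : Pt → Pt → Set
  _~_ = SameVertex m n

  ~-subst : ∀ {p p' q q'} → p ≡ p' → q ≡ q' → p ~ q → p' ~ q'
  ~-subst refl refl p~q = p~q

  ~-sym : ∀ {p q} → p ~ q → q ~ p
  ~-sym = reverse invert
    where
    invert : ∀ {p q} → GenStep m n p q → GenStep m n q p
    invert (by-t p) = by-t⁻¹ p
    invert (by-t⁻¹ p) = by-t p
    invert (by-τ p) = by-τ⁻¹ p
    invert (by-τ⁻¹ p) = by-τ p

  vertex-t : ∀ p → vertex (t m p) ≡ vertex p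
  vertex-t (x , y) = cong (λ a → fold a (y %ℕ 2n)) (%ℕ-≡ m _ (x %ℕ m) (x /ℕ m ℤ.+ + 1) (n%ℕd<d x m)
    (trans (cong (ℤ._+ + m) (a≡a%ℕn+[a/ℕn]*n x m)) (shift (+ (x %ℕ m)) (x /ℕ m) (+ m))))
    where
    shift : ∀ a b c → a ℤ.+ b ℤ.* c ℤ.+ c ≡ a ℤ.+ (b ℤ.+ + 1) ℤ.* c
    shift = ℤ-Solver.solve-∀

  reflect-%ℕ : ∀ x → (+ m ℤ.- + 1 ℤ.- x) %ℕ m ≡ m' ∸ x %ℕ m
  reflect-%ℕ x = %ℕ-≡ m _ (m' ∸ a) (ℤ.- (x /ℕ m)) (s≤s (ℕP.m∸n≤m m' a))
    (trans (cong (λ z → + m ℤ.- + 1 ℤ.- z) (a≡a%ℕn+[a/ℕn]*n x m))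
      (trans (negate (+ a) (x /ℕ m) (+ m)) (cong (λ z → z ℤ.+ ℤ.- (x /ℕ m) ℤ.* + m) m'-a)))
    where
    a = x %ℕ m
    negate : ∀ u v w → w ℤ.- + 1 ℤ.- (u ℤ.+ v ℤ.* w) ≡ w ℤ.- + 1 ℤ.- u ℤ.+ ℤ.- v ℤ.* w
    negate = ℤ-Solver.solve-∀
    m'-a : + m ℤ.- + 1 ℤ.- + a ≡ + (m' ∸ a)
    m'-a = trans (cong (ℤ._- + a) (sym (pos-∸ m 1 (s≤s z≤n))))
                 (sym (pos-∸ m' a (ℕP.≤-pred (n%ℕd<d x m))))

  vertex-τ : ∀ p → vertex (τ m n p) ≡ vertex p
  vertex-τ (x , y) with low⊎high (y %ℕ 2n)
  ... | inj₁ σ<n = begin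
    fold ((+ m ℤ.- + 1 ℤ.- x) %ℕ m) ((y ℤ.+ + n) %ℕ 2n)
      ≡⟨ cong₂ fold (reflect-%ℕ x) y+n ⟩
    fold (m' ∸ a) (σ + n)
      ≡⟨ fold-high (m' ∸ a) (σ + n) (ℕP.m≤n+m n σ) ⟩
    (m' ∸ (m' ∸ a) , σ + n ∸ n)
      ≡⟨ cong₂ _,_ (ℕP.m∸[m∸n]≡n (ℕP.≤-pred (n%ℕd<d x m))) (ℕP.m+n∸n≡m σ n) ⟩
    (a , σ)
      ≡⟨ sym (fold-low a σ σ<n) ⟩
    fold a σ ∎
    where
    open ≡-Reasoning
    a = x %ℕ m
    σ = y %ℕ 2n
    y+n : (y ℤ.+ + n) %ℕ 2n ≡ σ + n
    y+n = %ℕ-≡ 2n _ (σ + n) (y /ℕ 2n) (ℕP.+-monoˡ-< n σ<n)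
      (trans (cong (ℤ._+ + n) (a≡a%ℕn+[a/ℕn]*n y 2n)) (swap (+ σ) (y /ℕ 2n) (+ 2n) (+ n)))
      where
      swap : ∀ u v w z → u ℤ.+ v ℤ.* w ℤ.+ z ≡ u ℤ.+ z ℤ.+ v ℤ.* w
      swap = ℤ-Solver.solve-∀
  ... | inj₂ n≤σ = begin
    fold ((+ m ℤ.- + 1 ℤ.- x) %ℕ m) ((y ℤ.+ + n) %ℕ 2n)
      ≡⟨ cong₂ fold (reflect-%ℕ x) y+n ⟩
    fold (m' ∸ a) (σ ∸ n)
      ≡⟨ fold-low (m' ∸ a) (σ ∸ n) σ-n<n ⟩
    (m' ∸ a , σ ∸ n)
      ≡⟨ sym (fold-high a σ n≤σ) ⟩
    fold a σ ∎
    where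
    open ≡-Reasoning
    a = x %ℕ m
    σ = y %ℕ 2n
    σ-n<n : σ ∸ n < n
    σ-n<n = ℕP.+-cancelʳ-< _ _ n (subst (_< 2n) (sym (ℕP.m∸n+n≡m n≤σ)) (n%ℕd<d y 2n))
    y+n : (y ℤ.+ + n) %ℕ 2n ≡ σ ∸ n
    y+n = %ℕ-≡ 2n _ (σ ∸ n) (y /ℕ 2n ℤ.+ + 1) (ℕP.<-≤-trans σ-n<n (ℕP.m≤m+n n n))
      (trans (cong (ℤ._+ + n) (a≡a%ℕn+[a/ℕn]*n y 2n))
        (trans (wrap (+ σ) (y /ℕ 2n) (+ n))
          (cong (λ z → z ℤ.+ (y /ℕ 2n ℤ.+ + 1) ℤ.* + 2n) (sym (pos-∸ σ n n≤σ)))))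
      where
      wrap : ∀ u v z → u ℤ.+ v ℤ.* (z ℤ.+ z) ℤ.+ z ≡ u ℤ.- z ℤ.+ (v ℤ.+ + 1) ℤ.* (z ℤ.+ z)
      wrap = ℤ-Solver.solve-∀

  ~⇒vertex≡ : ∀ {p q} → p ~ q → vertex p ≡ vertex q
  ~⇒vertex≡ ε = refl
  ~⇒vertex≡ (s ◅ ss) = trans (step s) (~⇒vertex≡ ss)
    where
    step : ∀ {p q} → GenStep m n p q → vertex p ≡ vertex q
    step (by-t p) = sym (vertex-t p)
    step (by-t⁻¹ p) = vertex-t p
    step (by-τ p) = sym (vertex-τ p)
    step (by-τ⁻¹ p) = vertex-τ p

  ~-shiftX-ℕ : ∀ k x y → (x , y) ~ (x ℤ.+ + k ℤ.* + m , y)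
  ~-shiftX-ℕ zero x y = ~-subst refl (cong (_, y) (sym (ℤP.+-identityʳ x))) ε
  ~-shiftX-ℕ (suc k) x y = ~-shiftX-ℕ k x y ◅◅
    ~-subst refl (cong (_, y) (shift x (+ k) (+ m))) (by-t (x ℤ.+ + k ℤ.* + m , y) ◅ ε)
    where
    shift : ∀ u v w → u ℤ.+ v ℤ.* w ℤ.+ w ≡ u ℤ.+ (+ 1 ℤ.+ v) ℤ.* w
    shift = ℤ-Solver.solve-∀

  ~-shiftX : ∀ q x y → (x , y) ~ (x ℤ.+ q ℤ.* + m , y)
  ~-shiftX (+ k) x y = ~-shiftX-ℕ k x y
  ~-shiftX -[1+ k ] x y = ~-sym (~-subst refl (cong (_, y) (cancel x (+ suc k) (+ m)))
    (~-shiftX-ℕ (suc k) (x ℤ.+ -[1+ k ] ℤ.* + m) y))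
    where
    cancel : ∀ u v w → u ℤ.+ (ℤ.- v) ℤ.* w ℤ.+ v ℤ.* w ≡ u
    cancel = ℤ-Solver.solve-∀

  ~-τ² : ∀ x y → (x , y) ~ (x , y ℤ.+ + 2n)
  ~-τ² x y = by-τ (x , y) ◅ ~-subst refl
    (cong₂ _,_ (reflect² x (+ m)) (ℤP.+-assoc y (+ n) (+ n))) (by-τ (τ m n (x , y)) ◅ ε)
    where
    reflect² : ∀ u w → w ℤ.- + 1 ℤ.- (w ℤ.- + 1 ℤ.- u) ≡ u
    reflect² = ℤ-Solver.solve-∀

  ~-shiftY-ℕ : ∀ k x y → (x , y) ~ (x , y ℤ.+ + k ℤ.* + 2n)
  ~-shiftY-ℕ zero x y = ~-subst refl (cong (x ,_) (sym (ℤP.+-identityʳ y))) ε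
  ~-shiftY-ℕ (suc k) x y = ~-shiftY-ℕ k x y ◅◅
    ~-subst refl (cong (x ,_) (shift y (+ k) (+ 2n))) (~-τ² x (y ℤ.+ + k ℤ.* + 2n))
    where
    shift : ∀ u v w → u ℤ.+ v ℤ.* w ℤ.+ w ≡ u ℤ.+ (+ 1 ℤ.+ v) ℤ.* w
    shift = ℤ-Solver.solve-∀

  ~-shiftY : ∀ q x y → (x , y) ~ (x , y ℤ.+ q ℤ.* + 2n)
  ~-shiftY (+ k) x y = ~-shiftY-ℕ k x y
  ~-shiftY -[1+ k ] x y = ~-sym (~-subst refl (cong (x ,_) (cancel y (+ suc k) (+ 2n)))
    (~-shiftY-ℕ (suc k) x (y ℤ.+ -[1+ k ] ℤ.* + 2n)))
    where
    cancel : ∀ u v w → u ℤ.+ (ℤ.- v) ℤ.* w ℤ.+ v ℤ.* w ≡ u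
    cancel = ℤ-Solver.solve-∀

  ~-reduce : ∀ x y → (x , y) ~ (+ (x %ℕ m) , + (y %ℕ 2n))
  ~-reduce x y =
    ~-subst refl (cong (_, y) (remainder x m)) (~-shiftX (ℤ.- (x /ℕ m)) x y) ◅◅
    ~-subst refl (cong (+ (x %ℕ m) ,_) (remainder y 2n)) (~-shiftY (ℤ.- (y /ℕ 2n)) (+ (x %ℕ m)) y)
    where
    cancel : ∀ u v w → u ℤ.+ v ℤ.* w ℤ.+ ℤ.- v ℤ.* w ≡ u
    cancel = ℤ-Solver.solve-∀
    remainder : ∀ z k .{{_ : NonZero k}} → z ℤ.+ ℤ.- (z /ℕ k) ℤ.* + k ≡ + (z %ℕ k)
    remainder z k = trans (cong (λ w → w ℤ.+ ℤ.- (z /ℕ k) ℤ.* + k) (a≡a%ℕn+[a/ℕn]*n z k))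
                          (cancel (+ (z %ℕ k)) (z /ℕ k) (+ k))

  vertex≡⇒~ : ∀ p a b → vertex p ≡ (a , b) → p ~ (+ a , + b)
  vertex≡⇒~ (x , y) a b eq with low⊎high (y %ℕ 2n)
  ... | inj₁ σ<n = ~-subst refl (cong (λ (c : ℕ × ℕ) → (+ proj₁ c , + proj₂ c))
    (trans (sym (fold-low _ _ σ<n)) eq)) (~-reduce x y)
  ... | inj₂ n≤σ = ~-reduce x y ◅◅ ~-subst (cong₂ _,_ reflect unshift)
    (cong (λ (c : ℕ × ℕ) → (+ proj₁ c , + proj₂ c)) (trans (sym (fold-high _ _ n≤σ)) eq))
    (by-τ⁻¹ (+ (m' ∸ x %ℕ m) , + (y %ℕ 2n ∸ n)) ◅ ε)
    where
    reflect : + m ℤ.- + 1 ℤ.- + (m' ∸ x %ℕ m) ≡ + (x %ℕ m)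
    reflect = trans (cong₂ ℤ._-_ (sym (pos-∸ m 1 (s≤s z≤n))) (pos-∸ m' _ (ℕP.≤-pred (n%ℕd<d x m))))
                    (sub-sub (+ m') (+ (x %ℕ m)))
      where
      sub-sub : ∀ u v → u ℤ.- (u ℤ.- v) ≡ v
      sub-sub = ℤ-Solver.solve-∀
    unshift : + (y %ℕ 2n ∸ n) ℤ.+ + n ≡ + (y %ℕ 2n)
    unshift = cong +_ (ℕP.m∸n+n≡m n≤σ)

  vertex-bounded : ∀ p → proj₁ (vertex p) < m × proj₂ (vertex p) < n
  vertex-bounded (x , y) with low⊎high (y %ℕ 2n)
  ... | inj₁ σ<n rewrite fold-low (x %ℕ m) _ σ<n = n%ℕd<d x m , σ<n
  ... | inj₂ n≤σ rewrite fold-high (x %ℕ m) _ n≤σ = s≤s (ℕP.m∸n≤m m' (x %ℕ m)) ,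
    ℕP.+-cancelʳ-< _ _ n (subst (_< 2n) (sym (ℕP.m∸n+n≡m n≤σ)) (n%ℕd<d y 2n))

  Visits : (ℕ → Pt) → ℕ → ℕ → Set
  Visits pos a b = ∃ λ i → i < m * n × vertex (pos i) ≡ (a , b)

  -- With i ↦ vertex (pos i) read as a map Fin (m n) → Fin (m n), covering every vertex
  -- is surjectivity, so it is also injectivity, i.e. no vertex is visited twice.
  covering-walk⇒tour : (pos : ℕ → Pt) → pos 0 ≡ (+ 0 , + 0) →
    (∀ i → i < m * n → Adj𝒫 (pos i) (pos (suc i))) →
    (∀ a b → a < m → b < n → Visits pos a b) →
    pos (m * n) ≡ (+ m , + 0) → CylindricalTour m n
  covering-walk⇒tour pos start knight visits end = record
    { pos = pos ; start = start ; knight = knight ; distinct = distinct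
    ; covers = covers ; cylinder = inj₁ end }
    where
    encode : ℕ × ℕ → ℕ
    encode (a , b) = a + b * m
    encode< : ∀ i → encode (vertex (pos i)) < m * n
    encode< i = ℕP.<-≤-trans (ℕP.+-monoˡ-< (b * m) a<m)
                  (ℕP.≤-trans (ℕP.*-monoˡ-≤ m b<n) (ℕP.≤-reflexive (ℕP.*-comm n m)))
      where
      b = proj₂ (vertex (pos i))
      a<m = proj₁ (vertex-bounded (pos i))
      b<n = proj₂ (vertex-bounded (pos i))
    code : Fin (m * n) → Fin (m * n)
    code i = fromℕ< (encode< (toℕ i))
    toℕ-code : ∀ {i} (i<mn : i < m * n) → toℕ (code (fromℕ< i<mn)) ≡ encode (vertex (pos i))
    toℕ-code i<mn = trans (FinP.toℕ-fromℕ< _)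
      (cong (λ z → encode (vertex (pos z))) (FinP.toℕ-fromℕ< i<mn))
    code-surjective : ∀ k → ∃ λ i → code i ≡ k
    code-surjective k = fromℕ< i<mn , FinP.toℕ-injective (begin
      toℕ (code (fromℕ< i<mn))            ≡⟨ toℕ-code i<mn ⟩
      encode (vertex (pos i))             ≡⟨ cong encode visit ⟩
      toℕ k % m + (toℕ k / m) * m         ≡⟨ sym (ℕD.m≡m%n+[m/n]*n (toℕ k) m) ⟩
      toℕ k ∎)
      where
      open ≡-Reasoning
      k/m<n = ℕD.m<n*o⇒m/o<n (subst (toℕ k <_) (ℕP.*-comm m n) (FinP.toℕ<n k))
      hit = visits (toℕ k % m) (toℕ k / m) (ℕD.m%n<n (toℕ k) m) k/m<n
      i = proj₁ hit
      i<mn = proj₁ (proj₂ hit)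
      visit = proj₂ (proj₂ hit)
    distinct : ∀ i j → i < m * n → j < m * n → pos i ~ pos j → i ≡ j
    distinct i j i<mn j<mn pi~pj = begin
      i                     ≡⟨ sym (FinP.toℕ-fromℕ< i<mn) ⟩
      toℕ (fromℕ< i<mn)     ≡⟨ cong toℕ (surjective⇒injective code code-surjective _ _ same-code) ⟩
      toℕ (fromℕ< j<mn)     ≡⟨ FinP.toℕ-fromℕ< j<mn ⟩
      j ∎
      where
      open ≡-Reasoning
      same-code : code (fromℕ< i<mn) ≡ code (fromℕ< j<mn)
      same-code = FinP.toℕ-injective (trans (toℕ-code i<mn)
        (trans (cong encode (~⇒vertex≡ pi~pj)) (sym (toℕ-code j<mn))))
    covers : (a : Fin m) (b : Fin n) → ∃ λ i → i < m * n × pos i ~ (+ toℕ a , + toℕ b)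
    covers a b with visits (toℕ a) (toℕ b) (FinP.toℕ<n a) (FinP.toℕ<n b)
    ... | i , i<mn , visit = i , i<mn , vertex≡⇒~ (pos i) _ _ visit

  -- A walk (sx , sy) of length d n from (0 , 0) to (d , 0) is repeated c = m / d times,
  -- each copy shifted by d.  The copies cover every vertex as soon as the walk meets
  -- each row b with each column residue e mod d, either directly or, through τ, in
  -- row b + n with the reflected residue d - 1 - e.
  module Strip (d' c' : ℕ) (m≡dc : m ≡ suc d' * suc c') (sx sy : ℕ → ℕ)
    (sx0 : sx 0 ≡ 0) (sy0 : sy 0 ≡ 0) (sx-end : sx (suc d' * n) ≡ suc d') (sy-end : sy (suc d' * n) ≡ 0)
    (step : ∀ r → r < suc d' * n → Adj𝒫 (+ sx r , + sy r) (+ sx (suc r) , + sy (suc r)))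
    (residues : ∀ b e → b < n → e < suc d' → ∃ λ r → r < suc d' * n ×
       ((sy r % 2n ≡ b × sx r % suc d' ≡ e) ⊎ (sy r % 2n ≡ b + n × sx r % suc d' ≡ d' ∸ e)))
    where
    d c P : ℕ
    d = suc d'
    c = suc c'
    P = d * n

    pos : ℕ → Pt
    pos i = (+ (d * (i / P) + sx (i % P)) , + sy (i % P))

    mn≡cP : m * n ≡ c * P
    mn≡cP = trans (cong (_* n) m≡dc) (rotate d c n)
      where
      rotate : ∀ a b c → a * b * c ≡ b * (a * c)
      rotate = ℕ-Solver.solve-∀

    step-in-copy : ∀ i → Adj𝒫 (pos i)
      (+ (d * (i / P) + sx (suc (i % P))) , + sy (suc (i % P)))
    step-in-copy i = Adj𝒫-translate (d * (i / P)) 0 (sx (i % P)) (sy (i % P))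
      (sx (suc (i % P))) (sy (suc (i % P))) (step (i % P) (ℕD.m%n<n i P))

    knight : ∀ i → i < m * n → Adj𝒫 (pos i) (pos (suc i))
    knight i _ with ℕP.m≤n⇒m<n∨m≡n (ℕD.m%n<n i P)
    ... | inj₁ no-wrap = subst (Adj𝒫 (pos i))
      (cong₂ (λ u v → (+ (d * u + sx v) , + sy v)) (sym (proj₂ next)) (sym (proj₁ next)))
      (step-in-copy i)
      where
      next = suc-%-no-wrap P i no-wrap
    ... | inj₂ wrap = subst (Adj𝒫 (pos i)) (cong₂ (λ u v → (+ u , + v)) x≡ y≡) (step-in-copy i)
      where
      next = suc-%-wrap P i wrap
      x≡ : d * (i / P) + sx (suc (i % P)) ≡ d * (suc i / P) + sx (suc i % P)
      x≡ = begin
        d * (i / P) + sx (suc (i % P))  ≡⟨ cong (λ z → d * (i / P) + sx z) wrap ⟩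
        d * (i / P) + sx P              ≡⟨ cong (λ z → d * (i / P) + z) sx-end ⟩
        d * (i / P) + d                 ≡⟨ ℕP.+-comm (d * (i / P)) d ⟩
        d + d * (i / P)                 ≡⟨ sym (ℕP.*-suc d (i / P)) ⟩
        d * suc (i / P)                 ≡⟨ sym (ℕP.+-identityʳ _) ⟩
        d * suc (i / P) + 0             ≡⟨ cong₂ (λ u v → d * u + v) (sym (proj₂ next))
                                              (trans (sym sx0) (cong sx (sym (proj₁ next)))) ⟩
        d * (suc i / P) + sx (suc i % P) ∎
        where open ≡-Reasoning
      y≡ : sy (suc (i % P)) ≡ sy (suc i % P)
      y≡ = trans (cong sy wrap) (trans sy-end (trans (sym sy0) (cong sy (sym (proj₁ next)))))

    cylinder : pos (m * n) ≡ (+ m , + 0)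
    cylinder = trans (cong pos mn≡cP) (cong₂ (λ u v → (+ u , + v)) x≡ (trans (cong sy cP%P) sy0))
      where
      0<P : 0 < P
      0<P = ℕP.≤-trans (s≤s z≤n) (ℕP.m≤m*n d n)
      cP%P : c * P % P ≡ 0
      cP%P = [r+jP]%P≡r P 0 c 0<P
      x≡ : d * (c * P / P) + sx (c * P % P) ≡ m
      x≡ = trans (cong₂ (λ u v → d * u + sx v) ([r+jP]/P≡j P 0 c 0<P) cP%P)
                 (trans (cong (λ z → d * c + z) sx0) (trans (ℕP.+-identityʳ _) (sym m≡dc)))

    in-range : ∀ r j → r < P → j < c → r + j * P < m * n
    in-range r j r<P j<c = subst (r + j * P <_) (sym mn≡cP)
      (ℕP.<-≤-trans (ℕP.+-monoˡ-< (j * P) r<P) (ℕP.*-monoˡ-≤ P j<c))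

    vertex-copy : ∀ r j → r < P → vertex (pos (r + j * P)) ≡ fold ((d * j + sx r) % m) (sy r % 2n)
    vertex-copy r j r<P = cong₂ (λ u v → fold ((d * u + sx v) % m) (sy v % 2n))
      ([r+jP]/P≡j P r j r<P) ([r+jP]%P≡r P r j r<P)

    visits : ∀ a b → a < m → b < n → Visits pos a b
    visits a b a<m b<n with residues b (a % d) b<n (ℕD.m%n<n a d)
    ... | r , r<P , inj₁ (y≡b , x≡e) =
      r + j * P , in-range r j r<P j<c ,
      trans (vertex-copy r j r<P) (trans (cong₂ fold dj+x≡a y≡b) (fold-low a b b<n))
      where
      offset = ∃-strip-offset d c m (sym m≡dc) (sx r) a x≡e a<m
      j = proj₁ offset
      j<c = proj₁ (proj₂ offset)
      dj+x≡a = proj₂ (proj₂ offset)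
    ... | r , r<P , inj₂ (y≡b+n , x≡d'-e) =
      r + j * P , in-range r j r<P j<c ,
      trans (vertex-copy r j r<P) (trans (cong₂ fold dj+x≡m'-a y≡b+n)
        (trans (fold-high (m' ∸ a) (b + n) (ℕP.m≤n+m n b))
          (cong₂ _,_ (ℕP.m∸[m∸n]≡n (ℕP.≤-pred a<m)) (ℕP.m+n∸n≡m b n))))
      where
      offset = ∃-strip-offset d c m (sym m≡dc) (sx r) (m' ∸ a)
        (trans x≡d'-e (sym (reflect-% d c m (sym m≡dc) a a<m))) (s≤s (ℕP.m∸n≤m m' a))
      j = proj₁ offset
      j<c = proj₁ (proj₂ offset)
      dj+x≡m'-a = proj₂ (proj₂ offset)

    tour : CylindricalTour m n
    tour = covering-walk⇒tour pos
      (cong₂ (λ u v → (+ u , + v)) (trans (cong (_+ sx 0) (ℕP.*-zeroʳ d)) sx0) sy0)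
      knight visits cylinder

even⊎odd : ∀ b → ∃ λ h → b ≡ h + h ⊎ b ≡ suc (h + h)
even⊎odd zero = 0 , inj₁ refl
even⊎odd (suc b) with even⊎odd b
... | h , inj₁ b≡2h = h , inj₂ (cong suc b≡2h)
... | h , inj₂ b≡2h+1 = suc h , inj₁ (cong suc (trans b≡2h+1 (sym (ℕP.+-suc h h))))

module Tour-OddRows (m' k' : ℕ) where
  k 2k : ℕ
  k = suc k'
  2k = k + k
  open Vertices m' 2k

  -- Climb by (1 , 2) to (k , 2k), step by (2 , -1), descend by (-1 , -2) to (3 , 1)
  -- and finish by (-2 , -1) at (1 , 0).
  sx sy : ℕ → ℕ
  sx r with r ℕ.≤? k
  ... | yes _ = r
  ... | no _ with r ℕ.≤? 2k
  ...   | yes _ = 3 + (2k ∸ r)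
  ...   | no _ = 1
  sy r with r ℕ.≤? k
  ... | yes _ = r + r
  ... | no _ with r ℕ.≤? 2k
  ...   | yes _ = 1 + ((2k ∸ r) + (2k ∸ r))
  ...   | no _ = 0

  climbing : ∀ r → r ≤ k → sx r ≡ r × sy r ≡ r + r
  climbing r r≤k with r ℕ.≤? k
  ... | yes _ = refl , refl
  ... | no r≰k = ⊥-elim (r≰k r≤k)

  descending : ∀ r → k < r → r ≤ 2k → sx r ≡ 3 + (2k ∸ r) × sy r ≡ 1 + ((2k ∸ r) + (2k ∸ r))
  descending r k<r r≤2k with r ℕ.≤? k
  ... | yes r≤k = ⊥-elim (ℕP.<⇒≱ k<r r≤k)
  ... | no _ with r ℕ.≤? 2k
  ...   | yes _ = refl , refl
  ...   | no r≰2k = ⊥-elim (r≰2k r≤2k)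

  finished : ∀ r → 2k < r → sx r ≡ 1 × sy r ≡ 0
  finished r 2k<r with r ℕ.≤? k
  ... | yes r≤k = ⊥-elim (ℕP.<⇒≱ 2k<r (ℕP.≤-trans r≤k (ℕP.m≤m+n k k)))
  ... | no _ with r ℕ.≤? 2k
  ...   | yes r≤2k = ⊥-elim (ℕP.<⇒≱ 2k<r r≤2k)
  ...   | no _ = refl , refl

  2k∸[1+k]≡k' : 2k ∸ suc k ≡ k'
  2k∸[1+k]≡k' = ℕP.m+n∸n≡m k' k

  1*n≡n : 1 * n ≡ n
  1*n≡n = ℕP.*-identityˡ n

  move : ∀ r (c d : ℤ) → + sx (suc r) ℤ.- + sx r ≡ c → + sy (suc r) ℤ.- + sy r ≡ d →
    IsKnightMove (c , d) → Adj𝒫 (+ sx r , + sy r) (+ sx (suc r) , + sy (suc r))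
  move r = Adj𝒫-by-diffs {sx r} {sy r} {sx (suc r)} {sy (suc r)}

  step : ∀ r → r < 1 * n → Adj𝒫 (+ sx r , + sy r) (+ sx (suc r) , + sy (suc r))
  step r r<n with ℕP.<-cmp r k
  ... | tri< r<k _ _ = move r (+ 1) (+ 2)
    (rise 1 (proj₁ here) (trans (proj₁ there) (ℕP.+-comm 1 r)))
    (rise 2 (proj₂ here) (trans (proj₂ there) (up2 r))) (inj₁ (refl , refl))
    where
    here = climbing r (ℕP.<⇒≤ r<k)
    there = climbing (suc r) r<k
    up2 : ∀ a → suc a + suc a ≡ a + a + 2
    up2 = ℕ-Solver.solve-∀
  ... | tri≈ _ refl _ = move k (+ 2) (ℤ.- + 1)
    (rise 2 (proj₁ here) (trans (proj₁ there) (trans (cong (λ z → 3 + z) 2k∸[1+k]≡k') (right2 k'))))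
    (fall 1 (trans (proj₂ here) (down1 k')) (trans (proj₂ there) (cong (λ z → 1 + (z + z)) 2k∸[1+k]≡k')))
    (inj₂ (refl , refl))
    where
    here = climbing k ℕP.≤-refl
    there = descending (suc k) ℕP.≤-refl (s≤s (ℕP.m≤n+m k k'))
    right2 : ∀ a → 3 + a ≡ suc a + 2
    right2 = ℕ-Solver.solve-∀
    down1 : ∀ a → suc a + suc a ≡ 1 + (a + a) + 1
    down1 = ℕ-Solver.solve-∀
  ... | tri> _ _ k<r with ℕP.m≤n⇒m<n∨m≡n (ℕP.≤-pred (subst (r <_) 1*n≡n r<n))
  ...   | inj₁ r<2k = move r (ℤ.- + 1) (ℤ.- + 2)
    (fall 1 (trans (proj₁ here) (trans (cong (λ z → 3 + z) 2k∸r≡) (left1 u))) (proj₁ there))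
    (fall 2 (trans (proj₂ here) (trans (cong (λ z → 1 + (z + z)) 2k∸r≡) (down2 u))) (proj₂ there))
    (inj₁ (refl , refl))
    where
    here = descending r k<r (ℕP.<⇒≤ r<2k)
    there = descending (suc r) (ℕP.<-trans k<r (ℕP.n<1+n r)) r<2k
    u = 2k ∸ suc r
    2k∸r≡ : 2k ∸ r ≡ suc u
    2k∸r≡ = ℕP.+-∸-assoc 1 r<2k
    left1 : ∀ a → 3 + suc a ≡ 3 + a + 1
    left1 = ℕ-Solver.solve-∀
    down2 : ∀ a → 1 + (suc a + suc a) ≡ 1 + (a + a) + 2
    down2 = ℕ-Solver.solve-∀
  ...   | inj₂ refl = move 2k (ℤ.- + 2) (ℤ.- + 1)
    (fall 2 (trans (proj₁ here) (cong (λ z → 3 + z) (ℕP.n∸n≡0 2k))) (proj₁ there))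
    (fall 1 (trans (proj₂ here) (cong (λ z → 1 + (z + z)) (ℕP.n∸n≡0 2k))) (proj₂ there))
    (inj₂ (refl , refl))
    where
    here = descending 2k k<r ℕP.≤-refl
    there = finished (suc 2k) ℕP.≤-refl

  row-parity : ∀ b → b < n → ∃ λ r → r < 1 * n × sy r ≡ b
  row-parity b b<n with even⊎odd b
  ... | h , inj₁ b≡2h = h , subst (h <_) (sym 1*n≡n) (s≤s h≤2k) ,
    trans (proj₂ (climbing h h≤k)) (sym b≡2h)
    where
    h≤2k : h ≤ 2k
    h≤2k = ℕP.≤-trans (ℕP.m≤m+n h h) (subst (_≤ 2k) b≡2h (ℕP.≤-pred b<n))
    h≤k : h ≤ k
    h≤k with ℕP.≤-<-connex h k
    ... | inj₁ h≤k = h≤k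
    ... | inj₂ k<h = ⊥-elim (ℕP.<⇒≱ (subst (_< n) b≡2h b<n) (ℕP.+-mono-≤ k<h (ℕP.<⇒≤ k<h)))
  ... | h , inj₂ b≡2h+1 = 2k ∸ h , subst (2k ∸ h <_) (sym 1*n≡n) (s≤s (ℕP.m∸n≤m 2k h)) ,
    trans (proj₂ (descending (2k ∸ h) k<2k-h (ℕP.m∸n≤m 2k h)))
          (trans (cong (λ z → 1 + (z + z)) (ℕP.m∸[m∸n]≡n (ℕP.≤-trans (ℕP.<⇒≤ h<k) (ℕP.m≤m+n k k))))
                 (sym b≡2h+1))
    where
    h<k : h < k
    h<k with ℕP.≤-<-connex k h
    ... | inj₁ k≤h = ⊥-elim (ℕP.<⇒≱ (subst (_< n) b≡2h+1 b<n) (s≤s (ℕP.+-mono-≤ k≤h k≤h)))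
    ... | inj₂ h<k = h<k
    k<2k-h : k < 2k ∸ h
    k<2k-h = ℕP.m+n≤o⇒m≤o∸n (suc k) (ℕP.≤-trans (ℕP.≤-reflexive (cong suc (ℕP.+-comm k h)))
                                                (ℕP.+-monoˡ-≤ k h<k))

  residues : ∀ b e → b < n → e < 1 → ∃ λ r → r < 1 * n ×
    ((sy r % 2n ≡ b × sx r % 1 ≡ e) ⊎ (sy r % 2n ≡ b + n × sx r % 1 ≡ 0 ∸ e))
  residues b zero b<n _ with row-parity b b<n
  ... | r , r<n , sy≡b = r , r<n , inj₁ (trans (cong (_% 2n) sy≡b)
    (ℕD.m<n⇒m%n≡m (ℕP.<-≤-trans b<n (ℕP.m≤m+n n n))) , ℕD.n%1≡0 (sx r))
  residues b (suc e) _ (s≤s ())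

  tour : CylindricalTour m n
  tour = Strip.tour 0 m' (sym (ℕP.*-identityˡ m)) sx sy
    (proj₁ (climbing 0 z≤n)) (proj₂ (climbing 0 z≤n))
    (trans (cong sx 1*n≡n) (proj₁ (finished n ℕP.≤-refl)))
    (trans (cong sy 1*n≡n) (proj₂ (finished n ℕP.≤-refl)))
    step residues

parity : ℕ → ℕ
parity zero = 0
parity (suc r) = 1 ∸ parity r

parity≡0⊎1 : ∀ r → parity r ≡ 0 ⊎ parity r ≡ 1
parity≡0⊎1 zero = inj₁ refl
parity≡0⊎1 (suc r) with parity≡0⊎1 r
... | inj₁ p≡0 rewrite p≡0 = inj₂ refl
... | inj₂ p≡1 rewrite p≡1 = inj₁ refl

parity-double : ∀ h → parity (h + h) ≡ 0
parity-double zero = refl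
parity-double (suc h) rewrite ℕP.+-suc h h | parity-double h = refl

double%2≡0 : ∀ a → (a + a) % 2 ≡ 0
double%2≡0 a = trans (cong (_% 2) (trans (cong (λ z → a + z) (sym (ℕP.+-identityʳ a))) (ℕP.*-comm 2 a)))
                     (ℕD.m*n%n≡0 a 2)

module Tour-Even (c' j : ℕ) where
  L m' : ℕ
  L = suc j + suc j
  m' = c' + suc c'
  open Vertices m' (suc L)

  -- Jump to (1 , 2), zigzag up through columns 1 and 3 to row L + 1, jump to
  -- (4 , L + 3) and zigzag down through columns 4 and 2 to (2 , 0).
  sx sy : ℕ → ℕ
  sx r with r ℕ.≟ 0
  ... | yes _ = 0
  ... | no _ with r ℕ.≤? L
  ...   | yes _ = 3 ∸ (parity r + parity r)
  ...   | no _ = 2 + (parity r + parity r)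
  sy r with r ℕ.≟ 0
  ... | yes _ = 0
  ... | no _ with r ℕ.≤? L
  ...   | yes _ = suc r
  ...   | no _ = 2n ∸ r

  climbing : ∀ r → 1 ≤ r → r ≤ L → sx r ≡ 3 ∸ (parity r + parity r) × sy r ≡ suc r
  climbing r 1≤r r≤L with r ℕ.≟ 0
  ... | yes refl = ⊥-elim (ℕP.<⇒≱ 1≤r z≤n)
  ... | no _ with r ℕ.≤? L
  ...   | yes _ = refl , refl
  ...   | no r≰L = ⊥-elim (r≰L r≤L)

  descending : ∀ r → L < r → sx r ≡ 2 + (parity r + parity r) × sy r ≡ 2n ∸ r
  descending r L<r with r ℕ.≟ 0
  ... | yes refl = ⊥-elim (ℕP.<⇒≱ L<r z≤n)
  ... | no _ with r ℕ.≤? L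
  ...   | yes r≤L = ⊥-elim (ℕP.<⇒≱ L<r r≤L)
  ...   | no _ = refl , refl

  move : ∀ r (c d : ℤ) → + sx (suc r) ℤ.- + sx r ≡ c → + sy (suc r) ℤ.- + sy r ≡ d →
    IsKnightMove (c , d) → Adj𝒫 (+ sx r , + sy r) (+ sx (suc r) , + sy (suc r))
  move r = Adj𝒫-by-diffs {sx r} {sy r} {sx (suc r)} {sy (suc r)}

  1≤L : 1 ≤ L
  1≤L = s≤s z≤n

  2*n≡2n : 2 * n ≡ 2n
  2*n≡2n = cong (λ z → n + z) (ℕP.+-identityʳ n)

  n<2n : n < 2n
  n<2n = ℕP.m<m+n n (s≤s z≤n)

  2n∸[1+L]≡L+3 : 2n ∸ suc L ≡ suc L + 2
  2n∸[1+L]≡L+3 = trans (cong (_∸ suc L) (regroup L)) (ℕP.m+n∸n≡m (suc L + 2) (suc L))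
    where
    regroup : ∀ l → suc (suc l) + suc (suc l) ≡ suc l + 2 + suc l
    regroup = ℕ-Solver.solve-∀

  step-climbing : ∀ r → suc r < L → Adj𝒫 (+ sx (suc r) , + sy (suc r)) (+ sx (suc (suc r)) , + sy (suc (suc r)))
  step-climbing r r+1<L with parity≡0⊎1 (suc r)
  ... | inj₁ p≡0 = move (suc r) (ℤ.- + 2) (+ 1)
    (fall 2 (trans (proj₁ here) (cong (λ z → 3 ∸ (z + z)) p≡0))
            (trans (proj₁ there) (cong (λ z → 3 ∸ ((1 ∸ z) + (1 ∸ z))) p≡0)))
    (rise 1 (proj₂ here) (trans (proj₂ there) (ℕP.+-comm 1 (suc (suc r))))) (inj₂ (refl , refl))
    where
    here = climbing (suc r) (s≤s z≤n) (ℕP.<⇒≤ r+1<L)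
    there = climbing (suc (suc r)) (s≤s z≤n) r+1<L
  ... | inj₂ p≡1 = move (suc r) (+ 2) (+ 1)
    (rise 2 (trans (proj₁ here) (cong (λ z → 3 ∸ (z + z)) p≡1))
            (trans (proj₁ there) (cong (λ z → 3 ∸ ((1 ∸ z) + (1 ∸ z))) p≡1)))
    (rise 1 (proj₂ here) (trans (proj₂ there) (ℕP.+-comm 1 (suc (suc r))))) (inj₂ (refl , refl))
    where
    here = climbing (suc r) (s≤s z≤n) (ℕP.<⇒≤ r+1<L)
    there = climbing (suc (suc r)) (s≤s z≤n) r+1<L

  step-descending : ∀ r → L < suc r → suc r < 2n →
    Adj𝒫 (+ sx (suc r) , + sy (suc r)) (+ sx (suc (suc r)) , + sy (suc (suc r)))
  step-descending r L<r+1 r+1<2n with parity≡0⊎1 (suc r)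
  ... | inj₁ p≡0 = move (suc r) (+ 2) (ℤ.- + 1)
    (rise 2 (trans (proj₁ here) (cong (λ z → 2 + (z + z)) p≡0))
            (trans (proj₁ there) (cong (λ z → 2 + ((1 ∸ z) + (1 ∸ z))) p≡0)))
    (fall 1 (trans (proj₂ here) y≡) (proj₂ there)) (inj₂ (refl , refl))
    where
    here = descending (suc r) L<r+1
    there = descending (suc (suc r)) (ℕP.<-trans L<r+1 (ℕP.n<1+n _))
    y≡ : 2n ∸ suc r ≡ 2n ∸ suc (suc r) + 1
    y≡ = trans (ℕP.+-∸-assoc 1 r+1<2n) (ℕP.+-comm 1 _)
  ... | inj₂ p≡1 = move (suc r) (ℤ.- + 2) (ℤ.- + 1)
    (fall 2 (trans (proj₁ here) (cong (λ z → 2 + (z + z)) p≡1))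
            (trans (proj₁ there) (cong (λ z → 2 + ((1 ∸ z) + (1 ∸ z))) p≡1)))
    (fall 1 (trans (proj₂ here) y≡) (proj₂ there)) (inj₂ (refl , refl))
    where
    here = descending (suc r) L<r+1
    there = descending (suc (suc r)) (ℕP.<-trans L<r+1 (ℕP.n<1+n _))
    y≡ : 2n ∸ suc r ≡ 2n ∸ suc (suc r) + 1
    y≡ = trans (ℕP.+-∸-assoc 1 r+1<2n) (ℕP.+-comm 1 _)

  step-top : Adj𝒫 (+ sx L , + sy L) (+ sx (suc L) , + sy (suc L))
  step-top = move L (+ 1) (+ 2)
    (rise 1 (trans (proj₁ here) (cong (λ z → 3 ∸ (z + z)) parityL))
            (trans (proj₁ there) (cong (λ z → 2 + ((1 ∸ z) + (1 ∸ z))) parityL)))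
    (rise 2 (proj₂ here) (trans (proj₂ there) 2n∸[1+L]≡L+3)) (inj₁ (refl , refl))
    where
    here = climbing L 1≤L ℕP.≤-refl
    there = descending (suc L) ℕP.≤-refl
    parityL : parity L ≡ 0
    parityL = parity-double (suc j)

  step : ∀ r → r < 2 * n → Adj𝒫 (+ sx r , + sy r) (+ sx (suc r) , + sy (suc r))
  step zero _ = move 0 (+ 1) (+ 2) (rise {a = 0} 1 refl (proj₁ (climbing 1 ℕP.≤-refl 1≤L)))
    (rise {a = 0} 2 refl (proj₂ (climbing 1 ℕP.≤-refl 1≤L))) (inj₁ (refl , refl))
  step (suc r) r+1<2n with ℕP.<-cmp (suc r) L
  ... | tri< r+1<L _ _ = step-climbing r r+1<L
  ... | tri≈ _ r+1≡L _ = subst (λ z → Adj𝒫 (+ sx z , + sy z) (+ sx (suc z) , + sy (suc z))) (sym r+1≡L) step-top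
  ... | tri> _ _ L<r+1 = step-descending r L<r+1 (subst (suc r <_) 2*n≡2n r+1<2n)

  even-column : ∀ r → L < r → sx r % 2 ≡ 0
  even-column r L<r = trans (cong (_% 2) (trans (proj₁ (descending r L<r)) (regroup (parity r))))
                            (double%2≡0 (suc (parity r)))
    where
    regroup : ∀ a → 2 + (a + a) ≡ suc a + suc a
    regroup = ℕ-Solver.solve-∀

  odd-column : ∀ r → 1 ≤ r → r ≤ L → sx r % 2 ≡ 1
  odd-column r 1≤r r≤L with parity≡0⊎1 r
  ... | inj₁ p≡0 = cong (_% 2) (trans (proj₁ (climbing r 1≤r r≤L)) (cong (λ z → 3 ∸ (z + z)) p≡0))
  ... | inj₂ p≡1 = cong (_% 2) (trans (proj₁ (climbing r 1≤r r≤L)) (cong (λ z → 3 ∸ (z + z)) p≡1))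

  residues : ∀ b e → b < n → e < 2 → ∃ λ r → r < 2 * n ×
    ((sy r % 2n ≡ b × sx r % 2 ≡ e) ⊎ (sy r % 2n ≡ b + n × sx r % 2 ≡ 1 ∸ e))
  residues zero zero _ _ = 0 , s≤s z≤n , inj₁ (refl , refl)
  residues (suc b) zero b<n _ = r , subst (r <_) (sym 2*n≡2n) r<2n ,
    inj₁ (trans (cong (_% 2n) y≡) (ℕD.m<n⇒m%n≡m (ℕP.<-trans b<n n<2n)) , even-column r L<r)
    where
    r = 2n ∸ suc b
    b<2n : suc b ≤ 2n
    b<2n = ℕP.≤-trans (ℕP.<⇒≤ b<n) (ℕP.m≤m+n n n)
    r<2n : r < 2n
    r<2n = ℕP.∸-monoʳ-< {2n} {suc b} {0} (s≤s z≤n) b<2n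
    L<r : L < r
    L<r = ℕP.m+n≤o⇒m≤o∸n (suc L) {suc b} {2n} (ℕP.+-mono-≤ (ℕP.n≤1+n (suc L)) (ℕP.<⇒≤ b<n))
    y≡ : sy r ≡ suc b
    y≡ = trans (proj₂ (descending r L<r)) (ℕP.m∸[m∸n]≡n b<2n)
  residues zero (suc zero) _ _ = n , subst (n <_) (sym 2*n≡2n) n<2n ,
    inj₂ (trans (cong (_% 2n) y≡) (ℕD.m<n⇒m%n≡m n<2n) , even-column n L<n)
    where
    L<n : L < n
    L<n = s≤s (ℕP.n≤1+n L)
    y≡ : sy n ≡ n
    y≡ = trans (proj₂ (descending n L<n)) (ℕP.m+n∸n≡m n n)
  residues (suc zero) (suc zero) _ _ = suc L , subst (suc L <_) (sym 2*n≡2n) (ℕP.<-trans (ℕP.n<1+n _) n<2n) ,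
    inj₂ (trans (cong (_% 2n) (trans (proj₂ (descending (suc L) ℕP.≤-refl))
                                     (trans 2n∸[1+L]≡L+3 (ℕP.+-comm (suc L) 2))))
                (ℕD.m<n⇒m%n≡m (subst (_< 2n) (ℕP.+-comm n 1) (ℕP.+-monoʳ-< n (s≤s (s≤s z≤n))))) ,
          even-column (suc L) ℕP.≤-refl)
  residues (suc (suc b)) (suc zero) b<n _ =
    suc b , subst (suc b <_) (sym 2*n≡2n) (ℕP.<-trans (ℕP.<-trans (ℕP.n<1+n _) b<n) n<2n) ,
    inj₁ (trans (cong (_% 2n) (proj₂ (climbing (suc b) (s≤s z≤n) b<L)))
                (ℕD.m<n⇒m%n≡m (ℕP.<-trans b<n n<2n)) ,
          odd-column (suc b) (s≤s z≤n) b<L)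
    where
    b<L : suc b ≤ L
    b<L = ℕP.≤-pred (ℕP.≤-pred b<n)
  residues b (suc (suc e)) _ (s≤s (s≤s ()))

  tour : CylindricalTour m n
  tour = Strip.tour 1 c' (cong suc (cong (λ z → c' + suc z) (sym (ℕP.+-identityʳ c')))) sx sy refl refl
    (trans (cong sx 2*n≡2n) (trans (proj₁ (descending 2n L<2n)) (cong (λ z → 2 + (z + z)) (parity-double n))))
    (trans (cong sy 2*n≡2n) (trans (proj₂ (descending 2n L<2n)) (ℕP.n∸n≡0 2n)))
    step residues
    where
    L<2n : L < 2n
    L<2n = ℕP.<-trans (ℕP.n<1+n L) (ℕP.<-trans (ℕP.n<1+n _) n<2n)

tile-x tile-y : ℕ → ℕ
tile-x 1 = 2
tile-x 2 = 3
tile-x 3 = 1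
tile-x 4 = 0
tile-x 5 = 2
tile-x 6 = 3
tile-x 7 = 5
tile-x 8 = 4
tile-x _ = 0
tile-y 1 = 1
tile-y 2 = 3
tile-y 3 = 4
tile-y 4 = 2
tile-y 5 = 3
tile-y 6 = 1
tile-y 7 = 2
tile-y _ = 0

tile-step : ∀ r → r < 8 → Adj𝒫 (+ tile-x r , + tile-y r) (+ tile-x (suc r) , + tile-y (suc r))
tile-step 0 _ = inj₂ (refl , refl)
tile-step 1 _ = inj₁ (refl , refl)
tile-step 2 _ = inj₂ (refl , refl)
tile-step 3 _ = inj₁ (refl , refl)
tile-step 4 _ = inj₂ (refl , refl)
tile-step 5 _ = inj₁ (refl , refl)
tile-step 6 _ = inj₂ (refl , refl)
tile-step 7 _ = inj₁ (refl , refl)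
tile-step (suc (suc (suc (suc (suc (suc (suc (suc r)))))))) (s≤s (s≤s (s≤s (s≤s (s≤s (s≤s (s≤s (s≤s ()))))))))

module Tour-TwoRows-4∣m (c' : ℕ) where
  open Vertices (3 + 4 * c') 1

  residues : ∀ b e → b < 2 → e < 4 → ∃ λ r → r < 4 * 2 ×
    ((tile-y r % 4 ≡ b × tile-x r % 4 ≡ e) ⊎ (tile-y r % 4 ≡ b + 2 × tile-x r % 4 ≡ 3 ∸ e))
  residues 0 0 _ _ = 0 , ≤-lit , inj₁ (refl , refl)
  residues 0 1 _ _ = 3 , ≤-lit , inj₁ (refl , refl)
  residues 0 2 _ _ = 7 , ≤-lit , inj₂ (refl , refl)
  residues 0 3 _ _ = 4 , ≤-lit , inj₂ (refl , refl)
  residues 1 0 _ _ = 2 , ≤-lit , inj₂ (refl , refl)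
  residues 1 1 _ _ = 5 , ≤-lit , inj₂ (refl , refl)
  residues 1 2 _ _ = 1 , ≤-lit , inj₁ (refl , refl)
  residues 1 3 _ _ = 6 , ≤-lit , inj₁ (refl , refl)
  residues (suc (suc b)) _ (s≤s (s≤s ())) _
  residues _ (suc (suc (suc (suc e)))) _ (s≤s (s≤s (s≤s (s≤s ()))))

  tour : CylindricalTour m 2
  tour = Strip.tour 3 c' (m≡4[c'+1] c') tile-x tile-y refl refl refl refl tile-step residues
    where
    m≡4[c'+1] : ∀ c → suc (3 + 4 * c) ≡ 4 * suc c
    m≡4[c'+1] = ℕ-Solver.solve-∀

module Tour-OneRow (m'' : ℕ) where
  m' : ℕ
  m' = suc (suc m'')
  open Vertices m' 0

  -- Jump from (0 , 0) to (-1 , 2), then walk right along rows 1 and -1 by moves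
  -- (1 , ±2) to (m - 2 , ±1), and jump to (m , 0).
  wiggle : ℕ → ℤ
  wiggle i with parity i
  ... | zero = + 1
  ... | suc _ = -[1+ 0 ]

  pos : ℕ → Pt
  pos i with i ℕ.≟ 0
  ... | yes _ = (+ 0 , + 0)
  ... | no _ with i ℕ.≟ 1
  ...   | yes _ = (-[1+ 0 ] , + 2)
  ...   | no _ with i ℕ.≤? m'
  ...     | yes _ = (+ (i ∸ 1) , wiggle i)
  ...     | no _ = (+ m , + 0)

  pos-middle : ∀ i → 2 ≤ i → i ≤ m' → pos i ≡ (+ (i ∸ 1) , wiggle i)
  pos-middle i 2≤i i≤m' with i ℕ.≟ 0
  ... | yes refl = ⊥-elim (ℕP.<⇒≱ 2≤i z≤n)
  ... | no _ with i ℕ.≟ 1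
  ...   | yes refl = ⊥-elim (ℕP.<⇒≱ 2≤i (s≤s z≤n))
  ...   | no _ with i ℕ.≤? m'
  ...     | yes _ = refl
  ...     | no i≰m' = ⊥-elim (i≰m' i≤m')

  pos-end : pos m ≡ (+ m , + 0)
  pos-end with m ℕ.≤? m'
  ... | yes m≤m' = ⊥-elim (ℕP.<⇒≱ ℕP.≤-refl m≤m')
  ... | no _ = refl

  wiggle%2 : ∀ i → wiggle i %ℕ 2 ≡ 1
  wiggle%2 i with parity i
  ... | zero = refl
  ... | suc _ = refl

  wiggle-even : ∀ i → parity i ≡ 0 → wiggle i ≡ + 1
  wiggle-even i p≡0 with parity i | p≡0
  ... | zero | _ = refl

  wiggle-odd : ∀ i → parity i ≡ 1 → wiggle i ≡ -[1+ 0 ]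
  wiggle-odd i p≡1 with parity i | p≡1
  ... | suc _ | _ = refl

  wiggle-move : ∀ i → IsKnightMove (+ 1 , wiggle (suc i) ℤ.- wiggle i)
  wiggle-move i with parity≡0⊎1 i
  ... | inj₁ p≡0 rewrite wiggle-even i p≡0 | wiggle-odd (suc i) (cong (1 ∸_) p≡0) = inj₁ (refl , refl)
  ... | inj₂ p≡1 rewrite wiggle-odd i p≡1 | wiggle-even (suc i) (cong (1 ∸_) p≡1) = inj₁ (refl , refl)

  wiggle-jump : ∀ i → IsKnightMove (+ 2 , + 0 ℤ.- wiggle i)
  wiggle-jump i with parity≡0⊎1 i
  ... | inj₁ p≡0 rewrite wiggle-even i p≡0 = inj₂ (refl , refl)
  ... | inj₂ p≡1 rewrite wiggle-odd i p≡1 = inj₂ (refl , refl)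

  step-right : ∀ x (y y' : ℤ) → IsKnightMove (+ 1 , y' ℤ.- y) → Adj𝒫 (+ x , y) (+ suc x , y')
  step-right x y y' = subst (λ c → IsKnightMove (c , y' ℤ.- y))
    (sym (rise {x} {suc x} {x} 1 refl (ℕP.+-comm 1 x)))

  jump-right : ∀ x (y : ℤ) → IsKnightMove (+ 2 , + 0 ℤ.- y) → Adj𝒫 (+ x , y) (+ (x + 2) , + 0)
  jump-right x y = subst (λ c → IsKnightMove (c , + 0 ℤ.- y)) (sym (rise {x} {x + 2} {x} 2 refl refl))

  knight : ∀ i → i < m * 1 → Adj𝒫 (pos i) (pos (suc i))
  knight 0 _ = inj₁ (refl , refl)
  knight 1 _ = subst (Adj𝒫 (pos 1)) (sym (pos-middle 2 ℕP.≤-refl (s≤s (s≤s z≤n)))) (inj₂ (refl , refl))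
  knight (suc (suc i)) i+2<m
    with ℕP.m≤n⇒m<n∨m≡n (ℕP.≤-pred (subst (suc (suc i) <_) (ℕP.*-identityʳ m) i+2<m))
  ... | inj₁ i+2<m' = Adj𝒫-subst (pos-middle (suc (suc i)) (s≤s (s≤s z≤n)) (ℕP.<⇒≤ i+2<m'))
    (pos-middle (suc (suc (suc i))) (s≤s (s≤s z≤n)) i+2<m')
    (step-right (suc i) (wiggle (suc (suc i))) (wiggle (suc (suc (suc i)))) (wiggle-move (suc (suc i))))
  ... | inj₂ i+2≡m' = Adj𝒫-subst (pos-middle (suc (suc i)) (s≤s (s≤s z≤n)) (ℕP.≤-reflexive i+2≡m'))
    (trans (cong (λ z → pos (suc z)) i+2≡m') (trans pos-end (cong (λ z → (+ z , + 0)) m≡i+3)))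
    (jump-right (suc i) (wiggle (suc (suc i))) (wiggle-jump (suc (suc i))))
    where
    m≡i+3 : m ≡ suc i + 2
    m≡i+3 = trans (cong suc (sym i+2≡m')) (ℕP.+-comm 2 (suc i))

  visits : ∀ a b → a < m → b < 1 → Visits pos a b
  visits a zero a<m _ with a ℕ.≟ 0 | a ℕ.≟ m'
  ... | yes refl | _ = 0 , subst (0 <_) (sym (ℕP.*-identityʳ m)) (s≤s z≤n) , refl
  ... | no _ | yes refl = 1 , subst (1 <_) (sym (ℕP.*-identityʳ m)) (s≤s (s≤s z≤n)) ,
    trans (cong (λ z → fold z 0) (%ℕ-≡ m -[1+ 0 ] m' -[1+ 0 ] ℕP.≤-refl (-1≡m'-m (+ m'))))
          (fold-low m' 0 (s≤s z≤n))
    where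
    -1≡m'-m : ∀ u → -[1+ 0 ] ≡ u ℤ.+ -[1+ 0 ] ℤ.* (+ 1 ℤ.+ u)
    -1≡m'-m = ℤ-Solver.solve-∀
  ... | no a≢0 | no a≢m' = i , subst (i <_) (sym (ℕP.*-identityʳ m)) (s≤s i≤m') ,
    trans (cong vertex (pos-middle i 2≤i i≤m'))
      (trans (cong₂ fold (ℕD.m<n⇒m%n≡m (s≤s (ℕP.m∸n≤m m' a))) (wiggle%2 i))
        (trans (fold-high (m' ∸ a) 1 ℕP.≤-refl) (cong (_, 0) (ℕP.m∸[m∸n]≡n a≤m'))))
    where
    a≤m' : a ≤ m'
    a≤m' = ℕP.≤-pred a<m
    i : ℕ
    i = suc (m' ∸ a)
    2≤i : 2 ≤ i
    2≤i = s≤s (ℕP.m<n⇒0<n∸m (ℕP.≤∧≢⇒< a≤m' a≢m'))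
    i≤m' : i ≤ m'
    i≤m' = ℕP.∸-monoʳ-< {m'} {a} {0} (ℕP.n≢0⇒n>0 a≢0) a≤m'
  visits a (suc b) _ (s≤s ())

  tour : CylindricalTour m 1
  tour = covering-walk⇒tour pos refl knight visits (trans (cong pos (ℕP.*-identityʳ m)) pos-end)

module Tour-2×1 where
  open Vertices 1 0

  pos : ℕ → Pt
  pos 0 = (+ 0 , + 0)
  pos 1 = (+ 1 , + 2)
  pos _ = (+ 2 , + 0)

  knight : ∀ i → i < 2 * 1 → Adj𝒫 (pos i) (pos (suc i))
  knight 0 _ = inj₁ (refl , refl)
  knight 1 _ = inj₁ (refl , refl)
  knight (suc (suc i)) (s≤s (s≤s ()))

  visits : ∀ a b → a < 2 → b < 1 → Visits pos a b
  visits 0 0 _ _ = 0 , s≤s z≤n , refl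
  visits 1 0 _ _ = 1 , s≤s (s≤s z≤n) , refl
  visits (suc (suc a)) _ (s≤s (s≤s ())) _
  visits _ (suc b) _ (s≤s ())

  tour : CylindricalTour 2 1
  tour = covering-walk⇒tour pos refl knight visits refl

-- Indexed from 3, the index at which it takes over from the tiles.
suffix-x suffix-y : ℕ → ℕ
suffix-x 3 = 3
suffix-x 4 = 5
suffix-x 5 = 4
suffix-x 6 = 3
suffix-x 7 = 5
suffix-x 8 = 4
suffix-x 9 = 3
suffix-x 10 = 5
suffix-x 11 = 4
suffix-x 12 = 6
suffix-x _ = 0
suffix-y 3 = 2
suffix-y 4 = 1
suffix-y 5 = 3
suffix-y 6 = 1
suffix-y 7 = 0
suffix-y 8 = 2
suffix-y 9 = 4
suffix-y 10 = 3
suffix-y 11 = 1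
suffix-y _ = 0

suffix-step : ∀ s → 3 ≤ s → s < 12 →
  Adj𝒫 (+ suffix-x s , + suffix-y s) (+ suffix-x (suc s) , + suffix-y (suc s))
suffix-step 3 _ _ = inj₂ (refl , refl)
suffix-step 4 _ _ = inj₁ (refl , refl)
suffix-step 5 _ _ = inj₁ (refl , refl)
suffix-step 6 _ _ = inj₂ (refl , refl)
suffix-step 7 _ _ = inj₁ (refl , refl)
suffix-step 8 _ _ = inj₁ (refl , refl)
suffix-step 9 _ _ = inj₂ (refl , refl)
suffix-step 10 _ _ = inj₁ (refl , refl)
suffix-step 11 _ _ = inj₂ (refl , refl)
suffix-step 0 () _
suffix-step 1 (s≤s ()) _
suffix-step 2 (s≤s (s≤s ())) _
suffix-step (suc (suc (suc (suc (suc (suc (suc (suc (suc (suc (suc (suc s)))))))))))) _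
  (s≤s (s≤s (s≤s (s≤s (s≤s (s≤s (s≤s (s≤s (s≤s (s≤s (s≤s (s≤s ()))))))))))))

module Tour-TwoRows-m≡2mod4 (k : ℕ) where
  m' : ℕ
  m' = 5 + 4 * k
  open Vertices m' 1

  -- Moves to (2 , 1), (4 , 0) and (3 , 2); then k copies of the tile, the j-th
  -- translated by (3 + 4 j , 2); then the suffix translated by (4 k , 0), ending at (m , 0).
  prefix-x prefix-y : ℕ → ℕ
  prefix-x 0 = 0
  prefix-x 1 = 2
  prefix-x _ = 4
  prefix-y 0 = 0
  prefix-y 1 = 1
  prefix-y _ = 0

  pos : ℕ → Pt
  pos i with i ℕ.<? 3
  ... | yes _ = (+ prefix-x i , + prefix-y i)
  ... | no _ with (i ∸ 3) ℕ.<? 8 * k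
  ...   | yes _ = (+ (3 + 4 * ((i ∸ 3) / 8) + tile-x ((i ∸ 3) % 8)) , + (2 + tile-y ((i ∸ 3) % 8)))
  ...   | no _ = (+ (4 * k + suffix-x (i ∸ 8 * k)) , + suffix-y (i ∸ 8 * k))

  pos-prefix : ∀ i → i < 3 → pos i ≡ (+ prefix-x i , + prefix-y i)
  pos-prefix i i<3 with i ℕ.<? 3
  ... | yes _ = refl
  ... | no i≮3 = ⊥-elim (i≮3 i<3)

  pos-tile : ∀ j r → j < k → r < 8 → pos (3 + (r + j * 8)) ≡ (+ (3 + 4 * j + tile-x r) , + (2 + tile-y r))
  pos-tile j r j<k r<8 with (3 + (r + j * 8)) ℕ.<? 3
  ... | yes i<3 = ⊥-elim (ℕP.<⇒≱ i<3 (ℕP.m≤m+n 3 _))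
  ... | no _ with (r + j * 8) ℕ.<? 8 * k
  ...   | yes _ = cong₂ (λ u v → (+ (3 + 4 * u + tile-x v) , + (2 + tile-y v)))
                        ([r+jP]/P≡j 8 r j r<8) ([r+jP]%P≡r 8 r j r<8)
  ...   | no i≮8k = ⊥-elim (i≮8k (ℕP.<-≤-trans (ℕP.+-monoˡ-< (j * 8) r<8)
                                   (ℕP.≤-trans (ℕP.*-monoˡ-≤ 8 j<k) (ℕP.≤-reflexive (ℕP.*-comm k 8)))))

  pos-suffix : ∀ s → 3 ≤ s → pos (8 * k + s) ≡ (+ (4 * k + suffix-x s) , + suffix-y s)
  pos-suffix s 3≤s with (8 * k + s) ℕ.<? 3
  ... | yes i<3 = ⊥-elim (ℕP.<⇒≱ i<3 (ℕP.≤-trans 3≤s (ℕP.m≤n+m s (8 * k))))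
  ... | no _ with (8 * k + s ∸ 3) ℕ.<? 8 * k
  ...   | yes i<8k = ⊥-elim (ℕP.<⇒≱ i<8k (ℕP.≤-trans (ℕP.m≤m+n (8 * k) (s ∸ 3))
                                          (ℕP.≤-reflexive (sym (ℕP.+-∸-assoc (8 * k) 3≤s)))))
  ...   | no _ = cong (λ z → (+ (4 * k + suffix-x z) , + suffix-y z)) (ℕP.m+n∸m≡n (8 * k) s)

  2m≡12+8k : m * 2 ≡ 12 + 8 * k
  2m≡12+8k = expand k
    where
    expand : ∀ k → suc (5 + 4 * k) * 2 ≡ 12 + 8 * k
    expand = ℕ-Solver.solve-∀

  pos-corner : ∀ j → j ≤ k → pos (3 + j * 8) ≡ (+ (3 + 4 * j) , + 2)
  pos-corner j j≤k with ℕP.m≤n⇒m<n∨m≡n j≤k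
  ... | inj₁ j<k = trans (pos-tile j 0 j<k ≤-lit) (cong (λ z → (+ z , + 2)) (ℕP.+-identityʳ _))
  ... | inj₂ refl = trans (cong pos (swap j))
    (trans (pos-suffix 3 ℕP.≤-refl) (cong (λ z → (+ z , + 2)) (ℕP.+-comm (4 * j) 3)))
    where
    swap : ∀ j → 3 + j * 8 ≡ 8 * j + 3
    swap = ℕ-Solver.solve-∀

  knight-tiles : ∀ i → i < 8 * k → Adj𝒫 (pos (3 + i)) (pos (suc (3 + i)))
  knight-tiles i i<8k with ℕP.m≤n⇒m<n∨m≡n (ℕP.≤-pred r<8)
    where r<8 = ℕD.m%n<n i 8
  ... | inj₁ r<7 = Adj𝒫-subst (trans (cong (λ z → pos (3 + z)) i≡) (pos-tile j r j<k r<8))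
    (trans (cong (λ z → pos (suc (3 + z))) i≡) (pos-tile j (suc r) j<k (s≤s r<7)))
    (Adj𝒫-translate (3 + 4 * j) 2 (tile-x r) (tile-y r) (tile-x (suc r)) (tile-y (suc r))
      (tile-step r (ℕP.m<n⇒m<1+n r<7)))
    where
    j = i / 8
    r = i % 8
    r<8 = ℕD.m%n<n i 8
    j<k = ℕD.m<n*o⇒m/o<n (subst (i <_) (ℕP.*-comm 8 k) i<8k)
    i≡ = ℕD.m≡m%n+[m/n]*n i 8
  ... | inj₂ r≡7 = Adj𝒫-subst
    (trans (cong (λ z → pos (3 + z)) (trans i≡ (cong (_+ j * 8) r≡7))) (pos-tile j 7 j<k ℕP.≤-refl))
    (trans (cong (λ z → pos (suc (3 + z))) (trans i≡ (cong (_+ j * 8) r≡7))) (pos-corner (suc j) j<k))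
    (Adj𝒫-by-diffs {3 + 4 * j + 5} {4} {3 + 4 * suc j} {2} (ℤ.- + 1) (ℤ.- + 2)
      (fall {x' = 3 + 4 * suc j} 1 (next-corner j) refl) (fall {a = 2} 2 refl refl) (inj₁ (refl , refl)))
    where
    j = i / 8
    j<k = ℕD.m<n*o⇒m/o<n (subst (i <_) (ℕP.*-comm 8 k) i<8k)
    i≡ = ℕD.m≡m%n+[m/n]*n i 8
    next-corner : ∀ j → 3 + 4 * j + 5 ≡ 3 + 4 * suc j + 1
    next-corner = ℕ-Solver.solve-∀

  knight-suffix : ∀ s → 3 ≤ s → s < 12 → Adj𝒫 (pos (8 * k + s)) (pos (suc (8 * k + s)))
  knight-suffix s 3≤s s<12 = Adj𝒫-subst (pos-suffix s 3≤s)
    (trans (cong pos (sym (ℕP.+-suc (8 * k) s))) (pos-suffix (suc s) (ℕP.≤-trans 3≤s (ℕP.n≤1+n s))))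
    (Adj𝒫-translate (4 * k) 0 (suffix-x s) (suffix-y s) (suffix-x (suc s)) (suffix-y (suc s))
      (suffix-step s 3≤s s<12))

  knight : ∀ i → i < m * 2 → Adj𝒫 (pos i) (pos (suc i))
  knight 0 _ = inj₂ (refl , refl)
  knight 1 _ = inj₂ (refl , refl)
  knight 2 _ = subst (Adj𝒫 (pos 2)) (sym (pos-corner 0 z≤n)) (inj₁ (refl , refl))
  knight (suc (suc (suc i))) i+3<2m with ℕP.≤-<-connex (8 * k) i
  ... | inj₂ i<8k = knight-tiles i i<8k
  ... | inj₁ 8k≤i = subst (λ z → Adj𝒫 (pos z) (pos (suc z))) (sym 3+i≡)
    (knight-suffix s (ℕP.m≤m+n 3 _) s<12)
    where
    s = 3 + (i ∸ 8 * k)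
    3+i≡ : 3 + i ≡ 8 * k + s
    3+i≡ = trans (cong (λ z → 3 + z) (sym (ℕP.m+[n∸m]≡n 8k≤i))) (swap (8 * k) (i ∸ 8 * k))
      where
      swap : ∀ a b → 3 + (a + b) ≡ a + (3 + b)
      swap = ℕ-Solver.solve-∀
    s<12 : s < 12
    s<12 = ℕP.+-cancelˡ-< (8 * k) _ _
      (subst (_< 8 * k + 12) 3+i≡ (subst (3 + i <_) (trans 2m≡12+8k (ℕP.+-comm 12 (8 * k))) i+3<2m))

  m≡6+k*4 : m ≡ 6 + k * 4
  m≡6+k*4 = cong (λ z → 6 + z) (ℕP.*-comm 4 k)

  tile-in-range : ∀ j r → j < k → r < 8 → 3 + (r + j * 8) < m * 2
  tile-in-range j r j<k r<8 = subst (3 + (r + j * 8) <_) (sym 2m≡12+8k)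
    (ℕP.<-≤-trans (ℕP.+-monoʳ-< 3 r+8j<8k) (ℕP.+-mono-≤ {3} {12} ≤-lit (ℕP.≤-reflexive (ℕP.*-comm k 8))))
    where
    r+8j<8k : r + j * 8 < k * 8
    r+8j<8k = ℕP.<-≤-trans (ℕP.+-monoˡ-< (j * 8) r<8) (ℕP.*-monoˡ-≤ 8 j<k)

  suffix-in-range : ∀ s → s < 12 → 8 * k + s < m * 2
  suffix-in-range s s<12 = subst (8 * k + s <_) (sym (trans 2m≡12+8k (ℕP.+-comm 12 (8 * k))))
    (ℕP.+-monoʳ-< (8 * k) s<12)

  tile-column<m : ∀ j c → j < k → c ≤ 5 → 3 + 4 * j + c < m
  tile-column<m j c j<k c≤5 = s≤s (ℕP.≤-trans (ℕP.+-monoʳ-≤ (3 + 4 * j) c≤5)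
    (ℕP.≤-trans (ℕP.≤-reflexive (regroup j))
      (ℕP.≤-trans (ℕP.+-monoʳ-≤ 4 (ℕP.*-monoʳ-≤ 4 j<k)) (ℕP.n≤1+n _))))
    where
    regroup : ∀ j → 3 + 4 * j + 5 ≡ 4 + 4 * suc j
    regroup = ℕ-Solver.solve-∀

  suffix-column<m : ∀ c → c ≤ 5 → 4 * k + c < m
  suffix-column<m c c≤5 = s≤s (ℕP.≤-trans (ℕP.+-monoʳ-≤ (4 * k) c≤5)
    (ℕP.≤-reflexive (ℕP.+-comm (4 * k) 5)))

  via-tile : ∀ j r {a b} → j < k → r < 8 →
    vertex (+ (3 + 4 * j + tile-x r) , + (2 + tile-y r)) ≡ (a , b) → Visits pos a b
  via-tile j r j<k r<8 e =
    3 + (r + j * 8) , tile-in-range j r j<k r<8 , trans (cong vertex (pos-tile j r j<k r<8)) e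

  via-suffix : ∀ s {a b} → 3 ≤ s → s < 12 →
    vertex (+ (4 * k + suffix-x s) , + suffix-y s) ≡ (a , b) → Visits pos a b
  via-suffix s 3≤s s<12 e =
    8 * k + s , suffix-in-range s s<12 , trans (cong vertex (pos-suffix s 3≤s)) e

  via-prefix : ∀ i {a b} → i < 3 → vertex (+ prefix-x i , + prefix-y i) ≡ (a , b) → Visits pos a b
  via-prefix i i<3 e =
    i , ℕP.<-≤-trans i<3 (subst (3 ≤_) (sym 2m≡12+8k) (ℕP.m≤m+n 3 _)) , trans (cong vertex (pos-prefix i i<3)) e

  <m⇒<c+4k : ∀ {x} c → 6 ≤ c → x < m → x < c + k * 4
  <m⇒<c+4k {x} c 6≤c a<m = ℕP.<-≤-trans (subst (x <_) m≡6+k*4 a<m) (ℕP.+-monoˡ-≤ (k * 4) 6≤c)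

  vertex-direct : ∀ x y {a} → x < m → y % 4 < 2 → x ≡ a → vertex (+ x , + y) ≡ (a , y % 4)
  vertex-direct x y x<m low refl =
    trans (cong (λ z → fold z (y % 4)) (ℕD.m<n⇒m%n≡m x<m)) (fold-low x (y % 4) low)

  vertex-reflected : ∀ x y {a} → x < m → 2 ≤ y % 4 → m' ≡ a + x → vertex (+ x , + y) ≡ (a , y % 4 ∸ 2)
  vertex-reflected x y {a} x<m high m'≡a+x =
    trans (cong (λ z → fold z (y % 4)) (ℕD.m<n⇒m%n≡m x<m))
      (trans (fold-high x (y % 4) high) (cong (_, y % 4 ∸ 2) (m≡n+o⇒m∸o≡n m' x a m'≡a+x)))

  complement : ∀ {q} → q < k → ∃ λ w → w < k × k ≡ suc q + w
  complement {q} q<k with ℕP.m≤n⇒∃[o]m+o≡n q<k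
  ... | w , 1+q+w≡k = w , subst (w <_) 1+q+w≡k (s≤s (ℕP.m≤n+m w q)) , sym 1+q+w≡k

  -- Column a = ρ + 4 q is met either directly or, in rows 2 and 3 (which τ folds onto
  -- rows 0 and 1), at the reflected column m - 1 - a.
  row0 : ∀ ρ q → ρ < 4 → ρ + q * 4 < m → Visits pos (ρ + q * 4) 0
  row0 0 0 _ _ = via-prefix 0 ≤-lit refl
  row0 0 1 _ _ = via-prefix 2 ℕP.≤-refl (vertex-direct 4 0 ≤-lit ≤-lit refl)
  row0 0 (suc (suc j)) _ a<m =
    via-tile j 7 j<k ≤-lit (vertex-direct _ 4 (tile-column<m j 5 j<k ℕP.≤-refl) ≤-lit (column≡ j))
    where
    j<k = +4*-cancel-< 8 j k (<m⇒<c+4k 8 ≤-lit a<m)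
    column≡ : ∀ j → 3 + 4 * j + 5 ≡ suc (suc j) * 4
    column≡ = ℕ-Solver.solve-∀
  row0 1 0 _ _ = via-suffix 8 ≤-lit ≤-lit (vertex-reflected _ 2 (suffix-column<m 4 ≤-lit) ≤-lit (column≡ k))
    where
    column≡ : ∀ k → 5 + 4 * k ≡ 1 + (4 * k + 4)
    column≡ = ℕ-Solver.solve-∀
  row0 1 (suc q') _ a<m with ℕP.<-cmp q' k
  ... | tri≈ _ refl _ =
    via-suffix 7 ≤-lit ≤-lit (vertex-direct _ 0 (suffix-column<m 5 ℕP.≤-refl) ≤-lit (column≡ k))
    where
    column≡ : ∀ k → 4 * k + 5 ≡ 1 + suc k * 4
    column≡ = ℕ-Solver.solve-∀
  ... | tri< q'<k _ _ with complement q'<k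
  ...   | w , w<k , k≡ = via-tile w 3 w<k ≤-lit (vertex-reflected _ 6 (tile-column<m w 1 w<k ≤-lit) ≤-lit
    (trans (cong (λ z → 5 + 4 * z) k≡) (column≡ q' w)))
    where
    column≡ : ∀ q w → 5 + 4 * (suc q + w) ≡ 1 + suc q * 4 + (3 + 4 * w + 1)
    column≡ = ℕ-Solver.solve-∀
  row0 1 (suc q') _ a<m | tri> _ _ k<q' =
    ⊥-elim (ℕP.<⇒≱ (+4*-cancel-< 5 q' (suc k) (<m⇒<c+4k 9 ≤-lit a<m)) k<q')
  row0 2 0 _ _ = via-suffix 3 ℕP.≤-refl ≤-lit (vertex-reflected _ 2 (suffix-column<m 3 ≤-lit) ≤-lit (column≡ k))
    where
    column≡ : ∀ k → 5 + 4 * k ≡ 2 + (4 * k + 3)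
    column≡ = ℕ-Solver.solve-∀
  row0 2 (suc q') _ a<m with complement (+4*-cancel-< 6 q' k (<m⇒<c+4k 6 ℕP.≤-refl a<m))
  ... | w , w<k , k≡ = via-tile w 0 w<k ≤-lit (vertex-reflected _ 2 (tile-column<m w 0 w<k z≤n) ≤-lit
    (trans (cong (λ z → 5 + 4 * z) k≡) (column≡ q' w)))
    where
    column≡ : ∀ q w → 5 + 4 * (suc q + w) ≡ 2 + suc q * 4 + (3 + 4 * w + 0)
    column≡ = ℕ-Solver.solve-∀
  row0 3 q _ a<m with ℕP.<-cmp q k
  ... | tri≈ _ refl _ = via-suffix 9 ≤-lit ≤-lit (vertex-direct _ 4 (suffix-column<m 3 ≤-lit) ≤-lit (column≡ k))
    where
    column≡ : ∀ k → 4 * k + 3 ≡ 3 + k * 4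
    column≡ = ℕ-Solver.solve-∀
  ... | tri< q<k _ _ = via-tile q 4 q<k ≤-lit (vertex-direct _ 4 (tile-column<m q 0 q<k z≤n) ≤-lit (column≡ q))
    where
    column≡ : ∀ q → 3 + 4 * q + 0 ≡ 3 + q * 4
    column≡ = ℕ-Solver.solve-∀
  ... | tri> _ _ k<q = ⊥-elim (ℕP.<⇒≱ (+4*-cancel-< 3 q (suc k) (<m⇒<c+4k 7 ≤-lit a<m)) k<q)
  row0 (suc (suc (suc (suc ρ)))) _ (s≤s (s≤s (s≤s (s≤s ())))) _

  row1 : ∀ ρ q → ρ < 4 → ρ + q * 4 < m → Visits pos (ρ + q * 4) 1
  row1 0 0 _ _ = via-suffix 10 ≤-lit ≤-lit (vertex-reflected _ 3 (suffix-column<m 5 ℕP.≤-refl) ≤-lit (column≡ k))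
    where
    column≡ : ∀ k → 5 + 4 * k ≡ 0 + (4 * k + 5)
    column≡ = ℕ-Solver.solve-∀
  row1 0 (suc q') _ a<m with ℕP.<-cmp q' k
  ... | tri≈ _ refl _ = via-suffix 11 ≤-lit ℕP.≤-refl (vertex-direct _ 1 (suffix-column<m 4 ≤-lit) ≤-lit (column≡ k))
    where
    column≡ : ∀ k → 4 * k + 4 ≡ suc k * 4
    column≡ = ℕ-Solver.solve-∀
  ... | tri< q'<k _ _ with complement q'<k
  ...   | w , w<k , k≡ = via-tile w 1 w<k ≤-lit (vertex-reflected _ 3 (tile-column<m w 2 w<k ≤-lit) ≤-lit
    (trans (cong (λ z → 5 + 4 * z) k≡) (column≡ q' w)))
    where
    column≡ : ∀ q w → 5 + 4 * (suc q + w) ≡ suc q * 4 + (3 + 4 * w + 2)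
    column≡ = ℕ-Solver.solve-∀
  row1 0 (suc q') _ a<m | tri> _ _ k<q' =
    ⊥-elim (ℕP.<⇒≱ (+4*-cancel-< 4 q' (suc k) (<m⇒<c+4k 8 ≤-lit a<m)) k<q')
  row1 1 0 _ _ = via-suffix 5 ≤-lit ≤-lit (vertex-reflected _ 3 (suffix-column<m 4 ≤-lit) ≤-lit (column≡ k))
    where
    column≡ : ∀ k → 5 + 4 * k ≡ 1 + (4 * k + 4)
    column≡ = ℕ-Solver.solve-∀
  row1 1 (suc q') _ a<m with ℕP.<-cmp q' k
  ... | tri≈ _ refl _ = via-suffix 4 ≤-lit ≤-lit (vertex-direct _ 1 (suffix-column<m 5 ℕP.≤-refl) ≤-lit (column≡ k))
    where
    column≡ : ∀ k → 4 * k + 5 ≡ 1 + suc k * 4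
    column≡ = ℕ-Solver.solve-∀
  ... | tri< q'<k _ _ =
    via-tile q' 5 q'<k ≤-lit (vertex-direct _ 5 (tile-column<m q' 2 q'<k ≤-lit) ≤-lit (column≡ q'))
    where
    column≡ : ∀ q → 3 + 4 * q + 2 ≡ 1 + suc q * 4
    column≡ = ℕ-Solver.solve-∀
  ... | tri> _ _ k<q' = ⊥-elim (ℕP.<⇒≱ (+4*-cancel-< 5 q' (suc k) (<m⇒<c+4k 9 ≤-lit a<m)) k<q')
  row1 2 0 _ _ = via-prefix 1 ≤-lit (vertex-direct 2 1 ≤-lit ≤-lit refl)
  row1 2 (suc q') _ a<m =
    via-tile q' 2 q'<k ≤-lit (vertex-direct _ 5 (tile-column<m q' 3 q'<k ≤-lit) ≤-lit (column≡ q'))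
    where
    q'<k : q' < k
    q'<k = +4*-cancel-< 6 q' k (<m⇒<c+4k 6 ℕP.≤-refl a<m)
    column≡ : ∀ q → 3 + 4 * q + 3 ≡ 2 + suc q * 4
    column≡ = ℕ-Solver.solve-∀
  row1 3 q _ a<m with ℕP.<-cmp q k
  ... | tri≈ _ refl _ = via-suffix 6 ≤-lit ≤-lit (vertex-direct _ 1 (suffix-column<m 3 ≤-lit) ≤-lit (column≡ k))
    where
    column≡ : ∀ k → 4 * k + 3 ≡ 3 + k * 4
    column≡ = ℕ-Solver.solve-∀
  ... | tri< q<k _ _ with complement q<k
  ...   | w , w<k , k≡ = via-tile w 6 w<k ≤-lit (vertex-reflected _ 3 (tile-column<m w 3 w<k ≤-lit) ≤-lit
    (trans (cong (λ z → 5 + 4 * z) k≡) (column≡ q w)))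
    where
    column≡ : ∀ q w → 5 + 4 * (suc q + w) ≡ 3 + q * 4 + (3 + 4 * w + 3)
    column≡ = ℕ-Solver.solve-∀
  row1 3 q _ a<m | tri> _ _ k<q = ⊥-elim (ℕP.<⇒≱ (+4*-cancel-< 3 q (suc k) (<m⇒<c+4k 7 ≤-lit a<m)) k<q)
  row1 (suc (suc (suc (suc ρ)))) _ (s≤s (s≤s (s≤s (s≤s ())))) _

  visits : ∀ a b → a < m → b < 2 → Visits pos a b
  visits a b a<m b<2 = subst (λ z → Visits pos z b) (sym a≡) (go b b<2)
    where
    a≡ : a ≡ a % 4 + (a / 4) * 4
    a≡ = ℕD.m≡m%n+[m/n]*n a 4
    a<m' : a % 4 + (a / 4) * 4 < m
    a<m' = subst (_< m) a≡ a<m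
    go : ∀ b → b < 2 → Visits pos (a % 4 + (a / 4) * 4) b
    go 0 _ = row0 (a % 4) (a / 4) (ℕD.m%n<n a 4) a<m'
    go 1 _ = row1 (a % 4) (a / 4) (ℕD.m%n<n a 4) a<m'
    go (suc (suc b)) (s≤s (s≤s ()))

  cylinder : pos (m * 2) ≡ (+ m , + 0)
  cylinder = trans (cong pos (trans 2m≡12+8k (ℕP.+-comm 12 (8 * k))))
    (trans (pos-suffix 12 ≤-lit) (cong (λ z → (+ z , + 0)) (column≡ k)))
    where
    column≡ : ∀ k → 4 * k + 6 ≡ suc (5 + 4 * k)
    column≡ = ℕ-Solver.solve-∀

  tour : CylindricalTour m 2
  tour = covering-walk⇒tour pos refl knight visits cylinder

∣c∣≡1⇒c≡±1 : ∀ c → ∣ c ∣ ≡ 1 → c ≡ + 1 ⊎ c ≡ -[1+ 0 ]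
∣c∣≡1⇒c≡±1 (+ .1) refl = inj₁ refl
∣c∣≡1⇒c≡±1 -[1+ .0 ] refl = inj₂ refl

∣c∣≡2⇒c≡±2 : ∀ c → ∣ c ∣ ≡ 2 → c ≡ + 2 ⊎ c ≡ -[1+ 1 ]
∣c∣≡2⇒c≡±2 (+ .2) refl = inj₁ refl
∣c∣≡2⇒c≡±2 -[1+ .1 ] refl = inj₂ refl

Even : ℤ → Set
Even z = ∃ λ q → z ≡ q ℤ.* + 2

Even-+ : ∀ {a b} → Even a → Even b → Even (a ℤ.+ b)
Even-+ (q , refl) (q' , refl) = q ℤ.+ q' , sym (ℤP.*-distribʳ-+ (+ 2) q q')

knight-move-odd : ∀ c d → IsKnightMove (c , d) → Even (c ℤ.+ d ℤ.- + 1)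
knight-move-odd c d (inj₁ (∣c∣≡1 , ∣d∣≡2)) with ∣c∣≡1⇒c≡±1 c ∣c∣≡1 | ∣c∣≡2⇒c≡±2 d ∣d∣≡2
... | inj₁ refl | inj₁ refl = + 1 , refl
... | inj₁ refl | inj₂ refl = -[1+ 0 ] , refl
... | inj₂ refl | inj₁ refl = + 0 , refl
... | inj₂ refl | inj₂ refl = -[1+ 1 ] , refl
knight-move-odd c d (inj₂ (∣c∣≡2 , ∣d∣≡1)) with ∣c∣≡2⇒c≡±2 c ∣c∣≡2 | ∣c∣≡1⇒c≡±1 d ∣d∣≡1
... | inj₁ refl | inj₁ refl = + 1 , refl
... | inj₁ refl | inj₂ refl = + 0 , refl
... | inj₂ refl | inj₁ refl = -[1+ 0 ] , refl
... | inj₂ refl | inj₂ refl = -[1+ 1 ] , refl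

Even⇒2∣∣_∣ : ∀ {z} → Even z → 2 ∣ ∣ z ∣
Even⇒2∣∣_∣ (q , refl) = divides ∣ q ∣ (ℤP.abs-* q (+ 2))

2∣n⇒2∣m : ∀ {m n} → CylindricalTour m n → 2 ∣ n → 2 ∣ m
2∣n⇒2∣m {m} {n} T (divides h refl) = subst (2 ∣_) ∣x+y∣≡m (Even⇒2∣∣ x+y-even ∣)
  where
  open CylindricalTour T
  x y : ℕ → ℤ
  x i = proj₁ (pos i)
  y i = proj₂ (pos i)
  x+y-i-even : ∀ i → i ≤ m * n → Even (x i ℤ.+ y i ℤ.- + i)
  x+y-i-even zero _ rewrite start = + 0 , refl
  x+y-i-even (suc i) i<mn = subst Even (sym (regroup (x i) (y i) (x (suc i)) (y (suc i)) (+ i)))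
    (Even-+ (x+y-i-even i (ℕP.<⇒≤ i<mn))
      (knight-move-odd (x (suc i) ℤ.- x i) (y (suc i) ℤ.- y i) (knight i i<mn)))
    where
    regroup : ∀ a b a' b' i → a' ℤ.+ b' ℤ.- (+ 1 ℤ.+ i) ≡ (a ℤ.+ b ℤ.- i) ℤ.+ ((a' ℤ.- a) ℤ.+ (b' ℤ.- b) ℤ.- + 1)
    regroup = ℤ-Solver.solve-∀
  mn-even : Even (+ (m * n))
  mn-even = + (m * h) , trans (cong +_ (sym (ℕP.*-assoc m h 2))) (ℤP.pos-* (m * h) 2)
  x+y-even : Even (x (m * n) ℤ.+ y (m * n))
  x+y-even = subst Even (cancel (x (m * n) ℤ.+ y (m * n)) (+ (m * n)))
    (Even-+ (x+y-i-even (m * n) ℕP.≤-refl) mn-even)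
    where
    cancel : ∀ a b → a ℤ.- b ℤ.+ b ≡ a
    cancel = ℤ-Solver.solve-∀
  ∣x+y∣≡m : ∣ x (m * n) ℤ.+ y (m * n) ∣ ≡ m
  ∣x+y∣≡m with cylinder
  ... | inj₁ end≡m rewrite end≡m = cong ∣_∣ (ℤP.+-identityʳ (+ m))
  ... | inj₂ end≡-m rewrite end≡-m = trans (cong ∣_∣ (ℤP.+-identityʳ (ℤ.- + m))) (ℤP.∣-i∣≡∣i∣ (+ m))

module No-2×2-Tour (T : CylindricalTour 2 2) where
  open CylindricalTour T
  open Vertices 1 1

  x y dx dy : ℕ → ℤ
  x i = proj₁ (pos i)
  y i = proj₂ (pos i)
  dx i = x (suc i) ℤ.- x i
  dy i = y (suc i) ℤ.- y i

  a≡b+[a-b] : ∀ a b → a ≡ b ℤ.+ (a ℤ.- b)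
  a≡b+[a-b] = ℤ-Solver.solve-∀

  pos-suc : ∀ i → pos (suc i) ≡ (x i ℤ.+ dx i , y i ℤ.+ dy i)
  pos-suc i = cong₂ _,_ (a≡b+[a-b] (x (suc i)) (x i)) (a≡b+[a-b] (y (suc i)) (y i))

  short-move-loops : ∀ a b c d → ∣ c ∣ ≡ 1 → ∣ d ∣ ≡ 2 → (a , b) ~ (a ℤ.+ c , b ℤ.+ d)
  short-move-loops a b c d ∣c∣≡1 ∣d∣≡2 with ∣c∣≡1⇒c≡±1 c ∣c∣≡1 | ∣c∣≡2⇒c≡±2 d ∣d∣≡2
  ... | inj₁ refl | inj₁ refl = by-τ (a , b) ◅
    ~-subst refl (cong (_, b ℤ.+ + 2) (shift a)) (~-shiftX a (+ 2 ℤ.- + 1 ℤ.- a) (b ℤ.+ + 2))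
    where
    shift : ∀ a → + 2 ℤ.- + 1 ℤ.- a ℤ.+ a ℤ.* + 2 ≡ a ℤ.+ + 1
    shift = ℤ-Solver.solve-∀
  ... | inj₂ refl | inj₁ refl = by-τ (a , b) ◅
    ~-subst refl (cong (_, b ℤ.+ + 2) (shift a)) (~-shiftX (a ℤ.- + 1) (+ 2 ℤ.- + 1 ℤ.- a) (b ℤ.+ + 2))
    where
    shift : ∀ a → + 2 ℤ.- + 1 ℤ.- a ℤ.+ (a ℤ.- + 1) ℤ.* + 2 ≡ a ℤ.+ -[1+ 0 ]
    shift = ℤ-Solver.solve-∀
  ... | inj₁ refl | inj₂ refl =
    ~-subst refl (cong (_, b) (shift a)) (~-shiftX (ℤ.- a) a b) ◅◅
    ~-subst (cong (_ ,_) (unshift b)) refl (by-τ⁻¹ (a ℤ.+ + 1 , b ℤ.+ -[1+ 1 ]) ◅ ε)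
    where
    shift : ∀ a → a ℤ.+ (ℤ.- a) ℤ.* + 2 ≡ + 2 ℤ.- + 1 ℤ.- (a ℤ.+ + 1)
    shift = ℤ-Solver.solve-∀
    unshift : ∀ b → b ℤ.+ -[1+ 1 ] ℤ.+ + 2 ≡ b
    unshift = ℤ-Solver.solve-∀
  ... | inj₂ refl | inj₂ refl =
    ~-subst refl (cong (_, b) (shift a)) (~-shiftX (+ 1 ℤ.- a) a b) ◅◅
    ~-subst (cong (_ ,_) (unshift b)) refl (by-τ⁻¹ (a ℤ.+ -[1+ 0 ] , b ℤ.+ -[1+ 1 ]) ◅ ε)
    where
    shift : ∀ a → a ℤ.+ (+ 1 ℤ.- a) ℤ.* + 2 ≡ + 2 ℤ.- + 1 ℤ.- (a ℤ.+ -[1+ 0 ])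
    shift = ℤ-Solver.solve-∀
    unshift : ∀ b → b ℤ.+ -[1+ 1 ] ℤ.+ + 2 ≡ b
    unshift = ℤ-Solver.solve-∀

  end~start : pos 4 ~ pos 0
  end~start with cylinder
  ... | inj₁ end≡ = ~-subst (sym end≡) (sym start) (~-sym (~-shiftX (+ 1) (+ 0) (+ 0)))
  ... | inj₂ end≡ = ~-subst (sym end≡) (sym start) (~-sym (~-shiftX -[1+ 0 ] (+ 0) (+ 0)))

  long-moves : ∀ i → i < 4 → ∣ dx i ∣ ≡ 2 × ∣ dy i ∣ ≡ 1
  long-moves i i<4 with knight i i<4
  ... | inj₂ long = long
  ... | inj₁ (∣dx∣≡1 , ∣dy∣≡2) with ℕP.m≤n⇒m<n∨m≡n i<4
  ...   | inj₁ i+1<4 = ⊥-elim (ℕP.<⇒≢ (ℕP.n<1+n i) (distinct i (suc i) i<4 i+1<4 loop))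
    where loop = ~-subst refl (sym (pos-suc i)) (short-move-loops (x i) (y i) (dx i) (dy i) ∣dx∣≡1 ∣dy∣≡2)
  ...   | inj₂ refl = ⊥-elim (ℕP.<⇒≢ (s≤s z≤n) (sym (distinct 3 0 i<4 (s≤s z≤n) (loop ◅◅ end~start))))
    where loop = ~-subst refl (sym (pos-suc 3)) (short-move-loops (x 3) (y 3) (dx 3) (dy 3) ∣dx∣≡1 ∣dy∣≡2)

  Even-±2+±2 : ∀ a b → ∣ a ∣ ≡ 2 → ∣ b ∣ ≡ 2 → Even (a ℤ.+ b)
  Even-±2+±2 a b ∣a∣≡2 ∣b∣≡2 with ∣c∣≡2⇒c≡±2 a ∣a∣≡2 | ∣c∣≡2⇒c≡±2 b ∣b∣≡2
  ... | inj₁ refl | inj₁ refl = + 2 , refl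
  ... | inj₁ refl | inj₂ refl = + 0 , refl
  ... | inj₂ refl | inj₁ refl = + 0 , refl
  ... | inj₂ refl | inj₂ refl = -[1+ 1 ] , refl

  two-steps : ∀ a b c → c ≡ a ℤ.+ ((b ℤ.- a) ℤ.+ (c ℤ.- b))
  two-steps = ℤ-Solver.solve-∀

  no-return-in-two : ∀ i → suc (suc i) < 4 → y (suc (suc i)) ≡ y i → ⊥
  no-return-in-two i i+2<4 y≡ =
    ℕP.<⇒≢ i<i+2 (distinct i (suc (suc i)) (ℕP.<-trans i<i+2 i+2<4) i+2<4
      (~-subst refl (sym pos≡) (~-shiftX q (x i) (y i))))
    where
    i<i+2 : i < suc (suc i)
    i<i+2 = ℕP.<-trans (ℕP.n<1+n i) (ℕP.n<1+n _)
    even = Even-±2+±2 (dx i) (dx (suc i)) (proj₁ (long-moves i (ℕP.<-trans i<i+2 i+2<4)))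
                                          (proj₁ (long-moves (suc i) (ℕP.<-trans (ℕP.n<1+n _) i+2<4)))
    q = proj₁ even
    pos≡ : pos (suc (suc i)) ≡ (x i ℤ.+ q ℤ.* + 2 , y i)
    pos≡ = cong₂ _,_
      (trans (two-steps (x i) (x (suc i)) (x (suc (suc i)))) (cong (λ z → x i ℤ.+ z) (proj₂ even))) y≡

  adjacent-cancel : ∀ d₀ d₁ d₂ d₃ → ∣ d₀ ∣ ≡ 1 → ∣ d₁ ∣ ≡ 1 → ∣ d₂ ∣ ≡ 1 → ∣ d₃ ∣ ≡ 1 →
    d₀ ℤ.+ d₁ ℤ.+ d₂ ℤ.+ d₃ ≡ + 0 → (d₀ ℤ.+ d₁ ≡ + 0) ⊎ (d₁ ℤ.+ d₂ ≡ + 0)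
  adjacent-cancel d₀ d₁ d₂ d₃ ∣d₀∣ ∣d₁∣ ∣d₂∣ ∣d₃∣ sum≡0
    with ∣c∣≡1⇒c≡±1 d₀ ∣d₀∣ | ∣c∣≡1⇒c≡±1 d₁ ∣d₁∣ | ∣c∣≡1⇒c≡±1 d₂ ∣d₂∣ | ∣c∣≡1⇒c≡±1 d₃ ∣d₃∣
  ... | inj₁ refl | inj₂ refl | _ | _ = inj₁ refl
  ... | inj₂ refl | inj₁ refl | _ | _ = inj₁ refl
  ... | _ | inj₁ refl | inj₂ refl | _ = inj₂ refl
  ... | _ | inj₂ refl | inj₁ refl | _ = inj₂ refl
  ... | inj₁ refl | inj₁ refl | inj₁ refl | inj₁ refl with () ← sum≡0
  ... | inj₁ refl | inj₁ refl | inj₁ refl | inj₂ refl with () ← sum≡0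
  ... | inj₂ refl | inj₂ refl | inj₂ refl | inj₁ refl with () ← sum≡0
  ... | inj₂ refl | inj₂ refl | inj₂ refl | inj₂ refl with () ← sum≡0

  dy-sum≡0 : dy 0 ℤ.+ dy 1 ℤ.+ dy 2 ℤ.+ dy 3 ≡ + 0
  dy-sum≡0 = trans (telescope (y 0) (y 1) (y 2) (y 3) (y 4)) (cong₂ ℤ._-_ y4≡0 (cong proj₂ start))
    where
    telescope : ∀ a b c d e → (b ℤ.- a) ℤ.+ (c ℤ.- b) ℤ.+ (d ℤ.- c) ℤ.+ (e ℤ.- d) ≡ e ℤ.- a
    telescope = ℤ-Solver.solve-∀
    y4≡0 : y 4 ≡ + 0
    y4≡0 with cylinder
    ... | inj₁ end≡ = cong proj₂ end≡
    ... | inj₂ end≡ = cong proj₂ end≡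

  impossible : ⊥
  impossible with adjacent-cancel (dy 0) (dy 1) (dy 2) (dy 3)
    (proj₂ (long-moves 0 ≤-lit)) (proj₂ (long-moves 1 ≤-lit))
    (proj₂ (long-moves 2 ≤-lit)) (proj₂ (long-moves 3 ≤-lit)) dy-sum≡0
  ... | inj₁ cancel = no-return-in-two 0 ≤-lit (trans (two-steps (y 0) (y 1) (y 2))
    (trans (cong (λ z → y 0 ℤ.+ z) cancel) (ℤP.+-identityʳ (y 0))))
  ... | inj₂ cancel = no-return-in-two 1 ≤-lit (trans (two-steps (y 1) (y 2) (y 3))
    (trans (cong (λ z → y 1 ℤ.+ z) cancel) (ℤP.+-identityʳ (y 1))))

2*h≡h+h : ∀ h → h * 2 ≡ h + h
2*h≡h+h h = trans (ℕP.*-comm h 2) (cong (λ z → h + z) (ℕP.+-identityʳ h))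

even⊎odd-∣ : ∀ n → (∃ λ h → n ≡ h + h × 2 ∣ n) ⊎ (∃ λ h → n ≡ suc (h + h) × ¬ 2 ∣ n)
even⊎odd-∣ n with even⊎odd n
... | h , inj₁ n≡2h = inj₁ (h , n≡2h , divides h (trans n≡2h (sym (2*h≡h+h h))))
... | h , inj₂ n≡2h+1 = inj₂ (h , n≡2h+1 , λ { (divides q n≡2q) → ℕP.even≢odd q h (begin
  2 * q            ≡⟨ ℕP.*-comm 2 q ⟩
  q * 2            ≡⟨ sym n≡2q ⟩
  n                ≡⟨ n≡2h+1 ⟩
  suc (h + h)      ≡⟨ cong suc (sym (2*h≡h+h h)) ⟩
  suc (h * 2)      ≡⟨ cong suc (ℕP.*-comm h 2) ⟩
  suc (2 * h) ∎) })
  where open ≡-Reasoning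

tour-odd-rows : ∀ m h → 1 ≤ m → (2 ≤ m ⊎ 2 ≤ suc (h + h)) → CylindricalTour m (suc (h + h))
tour-odd-rows (suc m') (suc k') _ _ = Tour-OddRows.tour m' k'
tour-odd-rows 1 zero _ (inj₁ (s≤s ()))
tour-odd-rows 1 zero _ (inj₂ (s≤s ()))
tour-odd-rows 2 zero _ _ = Tour-2×1.tour
tour-odd-rows (suc (suc (suc m''))) zero _ _ = Tour-OneRow.tour m''

tour-two-rows : ∀ u' → CylindricalTour (suc (suc u') + suc (suc u')) 2
tour-two-rows u' with even⊎odd (suc (suc u'))
... | zero , inj₁ ()
... | zero , inj₂ ()
... | suc c' , inj₁ u≡2c = subst (λ m → CylindricalTour m 2)
  (sym (trans (cong (λ z → z + z) u≡2c) (4[c'+1]≡ c'))) (Tour-TwoRows-4∣m.tour c')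
  where
  4[c'+1]≡ : ∀ c → suc c + suc c + (suc c + suc c) ≡ suc (3 + 4 * c)
  4[c'+1]≡ = ℕ-Solver.solve-∀
... | suc k , inj₂ u≡2k+1 = subst (λ m → CylindricalTour m 2)
  (sym (trans (cong (λ z → z + z) u≡2k+1) (4k+6≡ k))) (Tour-TwoRows-m≡2mod4.tour k)
  where
  4k+6≡ : ∀ k → suc (suc k + suc k) + suc (suc k + suc k) ≡ suc (5 + 4 * k)
  4k+6≡ = ℕ-Solver.solve-∀

tour-even : ∀ u h → 1 ≤ u → 1 ≤ h → ¬ (u + u ≡ 2 × h + h ≡ 2) → CylindricalTour (u + u) (h + h)
tour-even (suc c') (suc (suc j)) _ _ _ = subst (CylindricalTour (suc c' + suc c'))
  (sym (regroup j)) (Tour-Even.tour c' j)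
  where
  regroup : ∀ j → suc (suc j) + suc (suc j) ≡ suc (suc (suc j + suc j))
  regroup = ℕ-Solver.solve-∀
tour-even (suc zero) (suc zero) _ _ not-2×2 = ⊥-elim (not-2×2 (refl , refl))
tour-even (suc (suc u')) (suc zero) _ _ _ = tour-two-rows u'

1≤h+h⇒1≤h : ∀ h → 1 ≤ h + h → 1 ≤ h
1≤h+h⇒1≤h (suc h) _ = s≤s z≤n

tour-exists : ∀ m n → 1 ≤ m → 1 ≤ n → (2 ≤ m ⊎ 2 ≤ n) →
  ¬ ((m ≡ 2 × n ≡ 2) ⊎ (¬ (2 ∣ m) × 2 ∣ n)) → CylindricalTour m n
tour-exists m n 1≤m 1≤n 2≤m⊎2≤n allowed with even⊎odd-∣ n | even⊎odd-∣ m
... | inj₂ (h , n≡2h+1 , _) | _ = subst (CylindricalTour m) (sym n≡2h+1)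
  (tour-odd-rows m h 1≤m (subst (λ z → 2 ≤ m ⊎ 2 ≤ z) n≡2h+1 2≤m⊎2≤n))
... | inj₁ (_ , _ , 2∣n) | inj₂ (_ , _ , 2∤m) = ⊥-elim (allowed (inj₂ (2∤m , 2∣n)))
... | inj₁ (h , n≡2h , _) | inj₁ (u , m≡2u , _) = subst₂ CylindricalTour (sym m≡2u) (sym n≡2h)
  (tour-even u h (1≤h+h⇒1≤h u (subst (1 ≤_) m≡2u 1≤m)) (1≤h+h⇒1≤h h (subst (1 ≤_) n≡2h 1≤n))
    (λ (2u≡2 , 2h≡2) → allowed (inj₁ (trans m≡2u 2u≡2 , trans n≡2h 2h≡2))))

theorem6p2 : (m n : ℕ) → 1 ≤ m → 1 ≤ n → (2 ≤ m ⊎ 2 ≤ n) →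
    (HasCylindricalTour m n ⇔ (¬ ((m ≡ 2 × n ≡ 2) ⊎ (¬ (2 ∣ m) × 2 ∣ n))))
theorem6p2 m n 1≤m 1≤n 2≤m⊎2≤n = mk⇔ obstruction (tour-exists m n 1≤m 1≤n 2≤m⊎2≤n)
  where
  obstruction : CylindricalTour m n → ¬ ((m ≡ 2 × n ≡ 2) ⊎ (¬ (2 ∣ m) × 2 ∣ n))
  obstruction T (inj₁ (refl , refl)) = No-2×2-Tour.impossible T
  obstruction T (inj₂ (2∤m , 2∣n)) = 2∤m (2∣n⇒2∣m T 2∣n)
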